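{- Consider the single load minimal cache demand problem with $c$ cores and total cache $K$. Call a job large if $a_j>\frac12$ and small otherwise. Algorithm $A_{3/2}$: assign each large job to its own core (one large job per core); let $s_i$ be the resulting load of core $i$ and $r_i=1-s_i$; process the small jobs in non-increasing order of cache demand $x_j$ and assign them to the cores taken in non-increasing order of $r_i$, continuing on a core until its load exceeds $1$ and then moving to the next core; allocate to each core the maximum cache demand of the jobs assigned to it; fail if more than $c$ cores or more than $2K$ cache are used. If there is a cache partition and job assignment of makespan at most $1$ that use $c$ cores and $K$ cache, then $A_{3/2}$ finds a cache partition and job assignment that use at most $2K$ cache, at most $c$ cores and have makespan at most $\frac32$.
   Context: Single load minimal cache demand problem: each job $j$ has a load $a_j>0$ and a minimal cache demand $x_j\ge0$. A solution is a cache partition $p$ giving $p(i)\ge0$ cache to each core with total $\sum_ip(i)$ (the cache used), and an assignment $S$ of jobs to cores such that every job $j$ is assigned to a core with $p(S(j))\ge x_j$. The load of a core is the sum of $a_j$ over jobs assigned to it; the makespan is the maximum load. -}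

module Defs where

open import Data.Nat as ℕ using (ℕ; zero; suc)
open import Data.Fin as Fin using (Fin; fromℕ<)
open import Data.Fin.Properties using () renaming (_≟_ to _≟ᶠ_)
open import Data.Rational using (ℚ; 0ℚ; 1ℚ; ½; _+_; _-_; _⊔_; _≤_; _<_)
open import Data.Rational.Properties using (_≤?_; _<?_)
open import Data.List using (List; []; _∷_; filter; foldr)
open import Data.List.Base using (allFin)
open import Data.Maybe using (Maybe; just; nothing)
open import Data.Bool using (Bool; true; false; if_then_else_)
open import Data.Product using (Σ; _×_; _,_)
open import Relation.Nullary using (yes; no; ¬?)
open import Relation.Nullary.Decidable using (⌊_⌋)

sumᶠ : ∀ {n} → (Fin n → ℚ) → ℚ
sumᶠ {zero}  f = 0ℚ
sumᶠ {suc n} f = f Fin.zero + sumᶠ (λ j → f (Fin.suc j))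

load : ∀ {n c} → (Fin n → ℚ) → (Fin n → Fin c) → Fin c → ℚ
load a S i = sumᶠ (λ j → if ⌊ S j ≟ᶠ i ⌋ then a j else 0ℚ)

ValidSolution : ∀ {n c} → (Fin n → ℚ) → (Fin c → ℚ) → (Fin n → Fin c) → Set
ValidSolution x p S = (∀ i → 0ℚ ≤ p i) × (∀ j → x j ≤ p (S j))

cacheUsed : ∀ {c} → (Fin c → ℚ) → ℚ
cacheUsed = sumᶠ

MakespanAtMost : ∀ {n c} → (Fin n → ℚ) → (Fin n → Fin c) → ℚ → Set
MakespanAtMost a S M = ∀ i → load a S i ≤ M

PAssign : ℕ → ℕ → Set
PAssign n c = Fin n → Maybe (Fin c)

isOn : ∀ {c} → Maybe (Fin c) → Fin c → Bool
isOn nothing  i = false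
isOn (just k) i = ⌊ k ≟ᶠ i ⌋

emptyAssign : ∀ {n c} → PAssign n c
emptyAssign _ = nothing

assignTo : ∀ {n c} → PAssign n c → Fin n → Fin c → PAssign n c
assignTo A j i j' = if ⌊ j' ≟ᶠ j ⌋ then just i else A j'

loadP : ∀ {n c} → (Fin n → ℚ) → PAssign n c → Fin c → ℚ
loadP a A i = sumᶠ (λ j → if isOn (A j) i then a j else 0ℚ)

cacheOf : ∀ {n c} → (Fin n → ℚ) → PAssign n c → Fin c → ℚ
cacheOf {n} x A i =
  foldr (λ j acc → if isOn (A j) i then x j ⊔ acc else acc) 0ℚ (allFin n)

largeJobs : ∀ {n} → (Fin n → ℚ) → List (Fin n)
largeJobs {n} a = filter (λ j → ½ <? a j) (allFin n)

smallJobs : ∀ {n} → (Fin n → ℚ) → List (Fin n)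
smallJobs {n} a = filter (λ j → ¬? (½ <? a j)) (allFin n)

placeLarge : ∀ {n c} → ℕ → List (Fin n) → PAssign n c → Maybe (PAssign n c)
placeLarge k [] A = just A
placeLarge {c = c} k (j ∷ js) A with k ℕ.<? c
... | yes k<c = placeLarge (suc k) js (assignTo A j (fromℕ< k<c))
... | no _    = nothing

initialAssign : ∀ {n c} → (Fin n → ℚ) → Maybe (PAssign n c)
initialAssign a = placeLarge 0 (largeJobs a) emptyAssign

residual : ∀ {n c} → (Fin n → ℚ) → PAssign n c → Fin c → ℚ
residual a A₀ i = 1ℚ - loadP a A₀ i

greedy : ∀ {n c} → (Fin n → ℚ) → PAssign n c → List (Fin c) → List (Fin n)
       → Maybe (PAssign n c)
greedy a A τ        []       = just A
greedy a A []       (j ∷ σ)  = nothing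
greedy a A (i ∷ τ)  (j ∷ σ)  =
  if ⌊ 1ℚ <? loadP a A i ⌋
    then greedy a A τ (j ∷ σ)
    else greedy a (assignTo A j i) (i ∷ τ) σ

-- The whole algorithm, given the core order τ and the small-job order σ
-- (the tie-breaking choices of the sorting steps).
runA32 : ∀ {n c} → (a x : Fin n → ℚ) → (K : ℚ) → List (Fin c) → List (Fin n)
       → Maybe (PAssign n c)
runA32 a x K τ σ with initialAssign a
... | nothing = nothing
... | just A₀ with greedy a A₀ τ σ
...   | nothing = nothing
...   | just A  with cacheUsed (cacheOf x A) ≤? (K + K)
...     | yes _ = just A
...     | no _  = nothing

module Submission where

-- No core of the optimum (p, S) holds two large jobs, so there are at most c of them, and the
-- greedy phase never runs out of cores: closed cores have load above 1 while the total load is at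
-- most c. A small job (load at most 1/2) only goes to a core of load at most 1, so no load exceeds
-- 3/2. The cache of a core is at most the demand of its large job plus the largest demand
-- m i of its small jobs. The large demands add up to at most K because the large jobs sit on
-- distinct cores of the optimum. For the small ones, if the core at position k gets m i = t > 0,
-- the optimum has at least k + 1 cores with cache t: the k earlier cores are full of small jobs of
-- demand at least t and of large jobs no heavier than that of core i, and a weighted count of what
-- the optimum must place on its cores with cache t exceeds their number otherwise. Pairing the
-- cores in order with such cores of the optimum bounds the sum of the m i by K as well.

open import Defs
open import Algebra.Bundles using (CommutativeMonoid)
open import Data.Bool using (Bool; true; false; if_then_else_; _∧_; not; T)
open import Data.Empty using (⊥-elim)
open import Data.Fin as Fin using (Fin)
open import Data.Fin.Properties using (suc-injective; toℕ-fromℕ<; toℕ-injective; toℕ<n) renaming (_≟_ to _≟ᶠ_)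
open import Data.List using (List; []; _∷_; length; filter; tabulate; _++_; foldr; lookup)
open import Data.List.Base using (allFin)
import Data.List.Properties as List
open import Data.List.Membership.Propositional using (_∈_; _∉_)
open import Data.List.Membership.Propositional.Properties using (∈-filter⁺; ∈-filter⁻; ∈-allFin; ∈-++⁺ʳ)
open import Data.List.Relation.Unary.All as All using (All)
open import Data.List.Relation.Unary.AllPairs using (AllPairs; _∷_)
open import Data.List.Relation.Unary.Any using (here; there; index)
open import Data.List.Relation.Unary.Any.Properties using (lookup-index)
open import Data.List.Relation.Unary.Linked as Linked using (Linked)
open import Data.List.Relation.Unary.Linked.Properties using (Linked⇒All; Linked⇒AllPairs)
open import Data.List.Relation.Unary.Unique.Propositional using (Unique)
import Data.List.Relation.Unary.Unique.Propositional.Properties as Unique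
open import Data.List.Relation.Binary.Permutation.Propositional as ↭ using (_↭_; ↭-sym)
open import Data.List.Relation.Binary.Permutation.Propositional.Properties using (∈-resp-↭; ↭-length)
import Data.List.Relation.Binary.Permutation.Setoid.Properties as ↭ₛ
open import Data.Maybe using (Maybe; just; nothing)
open import Data.Maybe.Properties using (just-injective)
open import Data.Nat as ℕ using (ℕ; zero; suc; z≤n; s≤s)
import Data.Nat.Properties as ℕₚ
open import Data.Product using (Σ; ∃-syntax; _×_; _,_; proj₂)
open import Data.Rational using (ℚ; 0ℚ; 1ℚ; ½; _+_; _-_; -_; _*_; _⊔_; _≤_; _<_; nonNegative)
open import Data.Rational.Properties
open import Data.Rational.Solver using (module +-*-Solver)
open import Data.Sum using (_⊎_; inj₁; inj₂)
open import Data.Unit using (tt)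
open import Data.Vec.Functional using (updateAt)
open import Data.Vec.Functional.Properties using (updateAt-updates; updateAt-minimal)
open import Function using (_∘_; case_of_)
open import Relation.Binary.PropositionalEquality
open import Relation.Nullary using (Dec; yes; no; ¬_; ¬?)
open import Relation.Nullary.Decidable using (⌊_⌋; does; proof; dec-true; dec-false)
open import Relation.Nullary.Reflects using (Reflects; invert)

open +-*-Solver
open import Algebra.Properties.CommutativeSemigroup (CommutativeMonoid.commutativeSemigroup +-0-commutativeMonoid)
  using (interchange; xy∙z≈xz∙y; xy∙z≈zx∙y)

ind : Bool → ℚ → ℚ
ind b q = if b then q else 0ℚ

ind-nonneg : ∀ b {q} → 0ℚ ≤ q → 0ℚ ≤ ind b q
ind-nonneg true  q≥0 = q≥0
ind-nonneg false _   = ≤-refl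

ind-≤ : ∀ b {q} → 0ℚ ≤ q → ind b q ≤ q
ind-≤ true  _   = ≤-refl
ind-≤ false q≥0 = q≥0

ind-mono-≤ : ∀ b {q r} → q ≤ r → ind b q ≤ ind b r
ind-mono-≤ true  q≤r = q≤r
ind-mono-≤ false _   = ≤-refl

ind-zero : ∀ b → ind b 0ℚ ≡ 0ℚ
ind-zero true  = refl
ind-zero false = refl

ind-distrib-+ : ∀ b q r → ind b (q + r) ≡ ind b q + ind b r
ind-distrib-+ true  q r = refl
ind-distrib-+ false q r = sym (+-identityˡ 0ℚ)

ind-∧ : ∀ b b′ q → ind (b ∧ b′) q ≡ ind b (ind b′ q)
ind-∧ true  b′ q = refl
ind-∧ false b′ q = refl

ind-comm : ∀ b b′ q → ind b (ind b′ q) ≡ ind b′ (ind b q)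
ind-comm true  true  q = refl
ind-comm true  false q = refl
ind-comm false true  q = refl
ind-comm false false q = refl

ind-≟-refl : ∀ {m} (k : Fin m) q → ind ⌊ k ≟ᶠ k ⌋ q ≡ q
ind-≟-refl k q with k ≟ᶠ k
... | yes _  = refl
... | no k≢k = ⊥-elim (k≢k refl)

⌊≟⌋-≢ : ∀ {m} {k l : Fin m} → k ≢ l → ⌊ k ≟ᶠ l ⌋ ≡ false
⌊≟⌋-≢ {k = k} {l} k≢l with k ≟ᶠ l
... | yes k≡l = ⊥-elim (k≢l k≡l)
... | no _    = refl

ind-≟-≢ : ∀ {m} {k l : Fin m} q → k ≢ l → ind ⌊ k ≟ᶠ l ⌋ q ≡ 0ℚ
ind-≟-≢ q k≢l = cong (λ b → ind b q) (⌊≟⌋-≢ k≢l)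

sumᶠ-cong : ∀ {n} {f g : Fin n → ℚ} → (∀ j → f j ≡ g j) → sumᶠ f ≡ sumᶠ g
sumᶠ-cong {zero}  f≗g = refl
sumᶠ-cong {suc n} f≗g = cong₂ _+_ (f≗g Fin.zero) (sumᶠ-cong (f≗g ∘ Fin.suc))

sumᶠ-mono-≤ : ∀ {n} {f g : Fin n → ℚ} → (∀ j → f j ≤ g j) → sumᶠ f ≤ sumᶠ g
sumᶠ-mono-≤ {zero}  f≤g = ≤-refl
sumᶠ-mono-≤ {suc n} f≤g = +-mono-≤ (f≤g Fin.zero) (sumᶠ-mono-≤ (f≤g ∘ Fin.suc))

sumᶠ-mono-< : ∀ {n} {f g : Fin n → ℚ} → (∀ j → f j ≤ g j) → ∀ k → f k < g k → sumᶠ f < sumᶠ g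
sumᶠ-mono-< {suc n} f≤g Fin.zero    fk<gk = +-mono-<-≤ fk<gk (sumᶠ-mono-≤ (f≤g ∘ Fin.suc))
sumᶠ-mono-< {suc n} f≤g (Fin.suc k) fk<gk = +-mono-≤-< (f≤g Fin.zero) (sumᶠ-mono-< (f≤g ∘ Fin.suc) k fk<gk)

sumᶠ-zero : ∀ {n} → sumᶠ {n} (λ _ → 0ℚ) ≡ 0ℚ
sumᶠ-zero {zero}  = refl
sumᶠ-zero {suc n} = trans (+-identityˡ _) (sumᶠ-zero {n})

sumᶠ-distrib-+ : ∀ {n} (f g : Fin n → ℚ) → sumᶠ (λ j → f j + g j) ≡ sumᶠ f + sumᶠ g
sumᶠ-distrib-+ {zero}  f g = sym (+-identityˡ 0ℚ)
sumᶠ-distrib-+ {suc n} f g = trans (cong (f Fin.zero + g Fin.zero +_) (sumᶠ-distrib-+ (f ∘ Fin.suc) (g ∘ Fin.suc)))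
                                   (interchange (f Fin.zero) (g Fin.zero) _ _)

sumᶠ-distribˡ-* : ∀ {n} α (f : Fin n → ℚ) → sumᶠ (λ j → α * f j) ≡ α * sumᶠ f
sumᶠ-distribˡ-* {zero}  α f = sym (*-zeroʳ α)
sumᶠ-distribˡ-* {suc n} α f = trans (cong (α * f Fin.zero +_) (sumᶠ-distribˡ-* α (f ∘ Fin.suc)))
                                    (sym (*-distribˡ-+ α _ _))

sumᶠ-nonneg : ∀ {n} {f : Fin n → ℚ} → (∀ j → 0ℚ ≤ f j) → 0ℚ ≤ sumᶠ f
sumᶠ-nonneg {n} {f} f≥0 = subst (_≤ sumᶠ f) (sumᶠ-zero {n}) (sumᶠ-mono-≤ f≥0)

term≤sumᶠ : ∀ {n} {f : Fin n → ℚ} → (∀ j → 0ℚ ≤ f j) → ∀ k → f k ≤ sumᶠ f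
term≤sumᶠ {suc n} {f} f≥0 Fin.zero =
  subst (_≤ sumᶠ f) (+-identityʳ (f Fin.zero)) (+-monoʳ-≤ (f Fin.zero) (sumᶠ-nonneg (f≥0 ∘ Fin.suc)))
term≤sumᶠ {suc n} {f} f≥0 (Fin.suc k) =
  subst (_≤ sumᶠ f) (+-identityˡ (f (Fin.suc k))) (+-mono-≤ (f≥0 Fin.zero) (term≤sumᶠ (f≥0 ∘ Fin.suc) k))

sumᶠ-comm : ∀ {m n} (G : Fin m → Fin n → ℚ) →
  sumᶠ (λ i → sumᶠ (λ j → G i j)) ≡ sumᶠ (λ j → sumᶠ (λ i → G i j))
sumᶠ-comm {zero}  {n} G = sym (sumᶠ-zero {n})
sumᶠ-comm {suc m}     G = trans (cong (sumᶠ (G Fin.zero) +_) (sumᶠ-comm (G ∘ Fin.suc)))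
                                (sym (sumᶠ-distrib-+ (G Fin.zero) (λ j → sumᶠ (λ i → G (Fin.suc i) j))))

sumᶠ-single : ∀ {n} (f : Fin n → ℚ) k → (∀ i → i ≢ k → f i ≡ 0ℚ) → sumᶠ f ≡ f k
sumᶠ-single {suc n} f Fin.zero f≡0 =
  trans (cong (f Fin.zero +_) (trans (sumᶠ-cong (λ j → f≡0 (Fin.suc j) λ ())) (sumᶠ-zero {n})))
        (+-identityʳ _)
sumᶠ-single {suc n} f (Fin.suc k) f≡0 =
  trans (cong₂ _+_ (f≡0 Fin.zero λ ()) (sumᶠ-single (f ∘ Fin.suc) k (λ i i≢k → f≡0 (Fin.suc i) (i≢k ∘ suc-injective))))
        (+-identityˡ _)

sumᶠ-δ : ∀ {n} k (G : Fin n → ℚ) → sumᶠ (λ i → ind ⌊ k ≟ᶠ i ⌋ (G i)) ≡ G k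
sumᶠ-δ k G = trans (sumᶠ-single _ k (λ i i≢k → ind-≟-≢ (G i) (i≢k ∘ sym))) (ind-≟-refl k (G k))

sumᶠ-δ′ : ∀ {n} k (G : Fin n → ℚ) → sumᶠ (λ i → ind ⌊ i ≟ᶠ k ⌋ (G i)) ≡ G k
sumᶠ-δ′ k G = trans (sumᶠ-single _ k (λ i i≢k → ind-≟-≢ (G i) i≢k)) (ind-≟-refl k (G k))

ind-distrib-sumᶠ : ∀ {n} b (f : Fin n → ℚ) → ind b (sumᶠ f) ≡ sumᶠ (λ j → ind b (f j))
ind-distrib-sumᶠ     true  f = refl
ind-distrib-sumᶠ {n} false f = sym (sumᶠ-zero {n})

toℚ : ℕ → ℚ
toℚ zero    = 0ℚ
toℚ (suc n) = 1ℚ + toℚ n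

count : ∀ {n} → (Fin n → Bool) → ℕ
count {zero}  b = 0
count {suc n} b = (if b Fin.zero then 1 else 0) ℕ.+ count (b ∘ Fin.suc)

0<1 : 0ℚ < 1ℚ
0<1 = positive⁻¹ 1ℚ

<⇒≱ : ∀ {p q} → p < q → ¬ q ≤ p
<⇒≱ p<q q≤p = <-irrefl refl (<-≤-trans p<q q≤p)

toℚ-mono-≤ : ∀ {m n} → m ℕ.≤ n → toℚ m ≤ toℚ n
toℚ-mono-≤ {zero} {zero}  z≤n     = ≤-refl
toℚ-mono-≤ {zero} {suc n} z≤n     =
  subst (_≤ toℚ (suc n)) (+-identityʳ 0ℚ) (+-mono-≤ (<⇒≤ 0<1) (toℚ-mono-≤ {zero} {n} z≤n))
toℚ-mono-≤ (s≤s m≤n) = +-monoʳ-≤ 1ℚ (toℚ-mono-≤ m≤n)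

toℚ-mono-< : ∀ {m n} → m ℕ.< n → toℚ m < toℚ n
toℚ-mono-< {m} {suc n} (s≤s m≤n) =
  ≤-<-trans (toℚ-mono-≤ m≤n) (subst (_< 1ℚ + toℚ n) (+-identityˡ (toℚ n)) (+-monoˡ-< (toℚ n) 0<1))

toℚ-cancel-≤ : ∀ {m n} → toℚ m ≤ toℚ n → m ℕ.≤ n
toℚ-cancel-≤ {m} {n} m≤n with m ℕ.≤? n
... | yes m≤n′ = m≤n′
... | no  m≰n  = ⊥-elim (<⇒≱ (toℚ-mono-< (ℕₚ.≰⇒> m≰n)) m≤n)

toℚ-cancel-< : ∀ {m n} → toℚ m < toℚ n → m ℕ.< n
toℚ-cancel-< {m} {n} m<n with m ℕ.<? n
... | yes m<n′ = m<n′
... | no  m≮n  = ⊥-elim (<⇒≱ m<n (toℚ-mono-≤ (ℕₚ.≮⇒≥ m≮n)))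

sumᶠ-ind-1 : ∀ {n} (b : Fin n → Bool) → sumᶠ (λ j → ind (b j) 1ℚ) ≡ toℚ (count b)
sumᶠ-ind-1 {zero}  b = refl
sumᶠ-ind-1 {suc n} b with b Fin.zero
... | true  = cong (1ℚ +_) (sumᶠ-ind-1 (b ∘ Fin.suc))
... | false = trans (+-identityˡ _) (sumᶠ-ind-1 (b ∘ Fin.suc))

sumᶠ-1 : ∀ n → sumᶠ {n} (λ _ → 1ℚ) ≡ toℚ n
sumᶠ-1 zero    = refl
sumᶠ-1 (suc n) = cong (1ℚ +_) (sumᶠ-1 n)

count-cong : ∀ {n} {b d : Fin n → Bool} → (∀ i → b i ≡ d i) → count b ≡ count d
count-cong {zero}  b≗d = refl
count-cong {suc n} b≗d = cong₂ ℕ._+_ (cong (λ v → if v then 1 else 0) (b≗d Fin.zero)) (count-cong (b≗d ∘ Fin.suc))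

count>0⇒∃ : ∀ {n} (b : Fin n → Bool) → 1 ℕ.≤ count b → ∃[ k ] b k ≡ true
count>0⇒∃ {suc n} b h with b Fin.zero in b0
... | true  = Fin.zero , b0
... | false = let k , bk = count>0⇒∃ (b ∘ Fin.suc) h in Fin.suc k , bk

count-≤-suc-of-agreeing : ∀ {n} (b d : Fin n → Bool) k → (∀ i → i ≢ k → d i ≡ b i) → count b ℕ.≤ suc (count d)
count-≤-suc-of-agreeing {suc n} b d Fin.zero d≗b
  rewrite count-cong {b = d ∘ Fin.suc} {b ∘ Fin.suc} (λ i → d≗b (Fin.suc i) λ ()) with b Fin.zero
... | true  = s≤s (ℕₚ.m≤n+m _ _)
... | false = ℕₚ.m≤n⇒m≤1+n (ℕₚ.m≤n+m _ _)
count-≤-suc-of-agreeing {suc n} b d (Fin.suc k) d≗b rewrite d≗b Fin.zero (λ ()) with b Fin.zero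
... | true  = s≤s (count-≤-suc-of-agreeing (b ∘ Fin.suc) (d ∘ Fin.suc) k (λ i i≢k → d≗b (Fin.suc i) (i≢k ∘ suc-injective)))
... | false =     count-≤-suc-of-agreeing (b ∘ Fin.suc) (d ∘ Fin.suc) k (λ i i≢k → d≗b (Fin.suc i) (i≢k ∘ suc-injective))

find : ∀ {n} (b : Fin n → Bool) → (∃[ k ] b k ≡ true) ⊎ (∀ k → b k ≡ false)
find {zero}  b = inj₂ λ ()
find {suc n} b with b Fin.zero in b0
... | true = inj₁ (Fin.zero , b0)
... | false with find (b ∘ Fin.suc)
...   | inj₁ (k , bk) = inj₁ (Fin.suc k , bk)
...   | inj₂ none     = inj₂ λ { Fin.zero → b0 ; (Fin.suc k) → none k }

-- Opaque, so that `rewrite` with the facts below never exposes the decision procedures on ℚ.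
abstract
  leqb : ℚ → ℚ → Bool
  leqb p q = does (p ≤? q)

  ltb : ℚ → ℚ → Bool
  ltb p q = does (p <? q)

  leqb⇒≤ : ∀ {p q} → leqb p q ≡ true → p ≤ q
  leqb⇒≤ {p} {q} e = invert (subst (Reflects _) e (proof (p ≤? q)))

  ≤⇒leqb : ∀ {p q} → p ≤ q → leqb p q ≡ true
  ≤⇒leqb {p} {q} = dec-true (p ≤? q)

  ltb⇒< : ∀ {p q} → ltb p q ≡ true → p < q
  ltb⇒< {p} {q} e = invert (subst (Reflects _) e (proof (p <? q)))

  <⇒ltb : ∀ {p q} → p < q → ltb p q ≡ true
  <⇒ltb {p} {q} = dec-true (p <? q)

  ≮⇒ltb : ∀ {p q} → ¬ p < q → ltb p q ≡ false
  ≮⇒ltb {p} {q} = dec-false (p <? q)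

  ltb-does : ∀ p q → ltb p q ≡ does (p <? q)
  ltb-does p q = refl

isOn⇒≡just : ∀ {c} (v : Maybe (Fin c)) l → isOn v l ≡ true → v ≡ just l
isOn⇒≡just (just k) l _ with k ≟ᶠ l
... | yes refl = refl

isOn-just : ∀ {c} (l : Fin c) → isOn (just l) l ≡ true
isOn-just l with l ≟ᶠ l
... | yes _  = refl
... | no l≢l = ⊥-elim (l≢l refl)

≡just⇒isOn : ∀ {c} {v : Maybe (Fin c)} {l} → v ≡ just l → isOn v l ≡ true
≡just⇒isOn {l = l} refl = isOn-just l

assignTo-self : ∀ {n c} (A : PAssign n c) j i → assignTo A j i j ≡ just i
assignTo-self A j i with j ≟ᶠ j
... | yes _  = refl
... | no j≢j = ⊥-elim (j≢j refl)

assignTo-other : ∀ {n c} (A : PAssign n c) {j} i {j′} → j′ ≢ j → assignTo A j i j′ ≡ A j′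
assignTo-other A {j} i {j′} j′≢j with j′ ≟ᶠ j
... | yes j′≡j = ⊥-elim (j′≢j j′≡j)
... | no _     = refl

OneJobPerCore : ∀ {n c} → PAssign n c → Set
OneJobPerCore A = ∀ {j j′ i} → A j ≡ just i → A j′ ≡ just i → j ≡ j′

loadP-assignTo : ∀ {n c} (a : Fin n → ℚ) (A : PAssign n c) {j} i l → A j ≡ nothing →
  loadP a (assignTo A j i) l ≡ loadP a A l + ind ⌊ i ≟ᶠ l ⌋ (a j)
loadP-assignTo a A {j} i l Aj≡nothing =
  trans (sumᶠ-cong split)
    (trans (sumᶠ-distrib-+ (λ j′ → ind (isOn (A j′) l) (a j′))
                           (λ j′ → ind ⌊ j′ ≟ᶠ j ⌋ (ind ⌊ i ≟ᶠ l ⌋ (a j′))))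
      (cong (loadP a A l +_) (sumᶠ-δ′ j (λ j′ → ind ⌊ i ≟ᶠ l ⌋ (a j′)))))
  where
  split : ∀ j′ → ind (isOn (assignTo A j i j′) l) (a j′)
               ≡ ind (isOn (A j′) l) (a j′) + ind ⌊ j′ ≟ᶠ j ⌋ (ind ⌊ i ≟ᶠ l ⌋ (a j′))
  split j′ with j′ ≟ᶠ j
  ... | yes refl rewrite Aj≡nothing = sym (+-identityˡ _)
  ... | no _     = sym (+-identityʳ _)

isIn : ∀ {c} → (Fin c → Bool) → Maybe (Fin c) → Bool
isIn B nothing  = false
isIn B (just l) = B l

is-assigned : ∀ {c} → Maybe (Fin c) → Bool
is-assigned = isIn (λ _ → true)

sumᶠ-ind-isOn : ∀ {c} (B : Fin c → Bool) (v : Maybe (Fin c)) w →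
  sumᶠ (λ l → ind (B l) (ind (isOn v l) w)) ≡ ind (isIn B v) w
sumᶠ-ind-isOn {c} B nothing  w = trans (sumᶠ-cong (λ l → ind-zero (B l))) (sumᶠ-zero {c})
sumᶠ-ind-isOn     B (just k) w = trans (sumᶠ-cong (λ l → ind-comm (B l) ⌊ k ≟ᶠ l ⌋ w)) (sumᶠ-δ k (λ l → ind (B l) w))

sumᶠ-isOn : ∀ {c} (v : Maybe (Fin c)) w → sumᶠ (λ l → ind (isOn v l) w) ≡ ind (is-assigned v) w
sumᶠ-isOn = sumᶠ-ind-isOn (λ _ → true)

sumᶠ-isIn : ∀ {n c} (B : Fin c → Bool) (A : PAssign n c) (w : Fin n → ℚ) →
  sumᶠ (λ l → ind (B l) (sumᶠ (λ j → ind (isOn (A j) l) (w j)))) ≡ sumᶠ (λ j → ind (isIn B (A j)) (w j))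
sumᶠ-isIn {n} B A w =
  trans (sumᶠ-cong (λ l → ind-distrib-sumᶠ {n} (B l) (λ j → ind (isOn (A j) l) (w j))))
    (trans (sumᶠ-comm (λ l j → ind (B l) (ind (isOn (A j) l) (w j))))
      (sumᶠ-cong (λ j → sumᶠ-ind-isOn B (A j) (w j))))

sumᶠ-loadP : ∀ {n c} (a : Fin n → ℚ) (A : PAssign n c) → (∀ j → 0ℚ ≤ a j) → sumᶠ (loadP a A) ≤ sumᶠ a
sumᶠ-loadP a A a≥0 =
  subst (_≤ sumᶠ a) (sym (sumᶠ-comm (λ l j → ind (isOn (A j) l) (a j))))
    (sumᶠ-mono-≤ λ j → subst (_≤ a j) (sym (sumᶠ-isOn (A j) (a j))) (ind-≤ (is-assigned (A j)) (a≥0 j)))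

private
  foldr-cache : ∀ {n c} (x : Fin n → ℚ) (A : PAssign n c) l → List (Fin n) → ℚ
  foldr-cache x A l = foldr (λ j acc → if isOn (A j) l then x j ⊔ acc else acc) 0ℚ

  foldr-cache-≤ : ∀ {n c} (x : Fin n → ℚ) (A : PAssign n c) l {B} (L : List (Fin n)) → 0ℚ ≤ B →
    (∀ j → isOn (A j) l ≡ true → x j ≤ B) → foldr-cache x A l L ≤ B
  foldr-cache-≤ x A l []      B≥0 x≤B = B≥0
  foldr-cache-≤ x A l (j ∷ L) B≥0 x≤B with isOn (A j) l in on
  ... | true  = ⊔-lub (x≤B j on) (foldr-cache-≤ x A l L B≥0 x≤B)
  ... | false = foldr-cache-≤ x A l L B≥0 x≤B

  ≤-foldr-cache : ∀ {n c} (x : Fin n → ℚ) (A : PAssign n c) l {j} (L : List (Fin n)) → j ∈ L → isOn (A j) l ≡ true →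
    x j ≤ foldr-cache x A l L
  ≤-foldr-cache x A l (j′ ∷ L) (here refl) on rewrite on = p≤p⊔q _ _
  ≤-foldr-cache x A l (j′ ∷ L) (there j∈) on with isOn (A j′) l
  ... | true  = ≤-trans (≤-foldr-cache x A l L j∈ on) (p≤q⊔p (x j′) _)
  ... | false = ≤-foldr-cache x A l L j∈ on

cacheOf-≤ : ∀ {n c} (x : Fin n → ℚ) (A : PAssign n c) l {B} → 0ℚ ≤ B →
  (∀ j → A j ≡ just l → x j ≤ B) → cacheOf x A l ≤ B
cacheOf-≤ {n} x A l B≥0 x≤B = foldr-cache-≤ x A l (allFin n) B≥0 (λ j on → x≤B j (isOn⇒≡just (A j) l on))

≤-cacheOf : ∀ {n c} (x : Fin n → ℚ) (A : PAssign n c) {j l} → A j ≡ just l → x j ≤ cacheOf x A l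
≤-cacheOf {n} x A {j} {l} Aj = ≤-foldr-cache x A l (allFin n) (∈-allFin j) (≡just⇒isOn Aj)

record Placement {n c} (L : List (Fin n)) (A A′ : PAssign n c) : Set where
  field
    unchanged : ∀ j → j ∉ L → A′ j ≡ A j
    placed    : ∀ j → j ∈ L → ∃[ i ] A′ j ≡ just i
    oneJob    : OneJobPerCore A′

-- The cores used so far have index below k, so core k is still free.
placeLarge-succeeds : ∀ {n c} k (L : List (Fin n)) (A : PAssign n c) →
  k ℕ.+ length L ℕ.≤ c → Unique L → (∀ j → j ∈ L → A j ≡ nothing) →
  (∀ {j i} → A j ≡ just i → Fin.toℕ i ℕ.< k) → OneJobPerCore A →
  ∃[ A′ ] placeLarge k L A ≡ just A′ × Placement L A A′
placeLarge-succeeds k [] A _ _ _ _ single =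
  A , refl , record { unchanged = λ _ _ → refl ; placed = λ _ () ; oneJob = single }
placeLarge-succeeds {c = c} k (j ∷ L) A fits (j∉L ∷ uniqueL) free below single with k ℕ.<? c
... | no k≮c = ⊥-elim (k≮c (ℕₚ.<-≤-trans (ℕₚ.m<m+n k (s≤s z≤n)) fits))
... | yes k<c =
  let A′ , run , P = placeLarge-succeeds (suc k) L A₁ fits′ uniqueL free′ below′ oneJob′
      open Placement P
  in A′ , run , record
       { unchanged = λ j′ j′∉ → trans (unchanged j′ (j′∉ ∘ there)) (assignTo-other A i (j′∉ ∘ here))
       ; placed    = λ { _ (here refl) → i , trans (unchanged j (λ j∈L → All.lookup j∉L j∈L refl)) (assignTo-self A j i)
                       ; j′ (there j′∈L) → placed j′ j′∈L }
       ; oneJob    = oneJob }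
  where
  i = Fin.fromℕ< k<c
  A₁ = assignTo A j i
  fits′ : suc k ℕ.+ length L ℕ.≤ c
  fits′ = ℕₚ.≤-trans (ℕₚ.≤-reflexive (sym (ℕₚ.+-suc k (length L)))) fits
  free′ : ∀ j′ → j′ ∈ L → A₁ j′ ≡ nothing
  free′ j′ j′∈L = trans (assignTo-other A i (λ j′≡j → All.lookup j∉L j′∈L (sym j′≡j))) (free j′ (there j′∈L))
  i-fresh : ∀ {j′ i′} → A j′ ≡ just i′ → i′ ≢ i
  i-fresh Aj′ refl = ℕₚ.<-irrefl (toℕ-fromℕ< k<c) (below Aj′)
  below′ : ∀ {j′ i′} → A₁ j′ ≡ just i′ → Fin.toℕ i′ ℕ.< suc k
  below′ {j′} A₁j′ with j′ ≟ᶠ j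
  ... | yes _ = ℕₚ.≤-reflexive (cong suc (trans (cong Fin.toℕ (just-injective (sym A₁j′))) (toℕ-fromℕ< k<c)))
  ... | no _  = ℕₚ.m≤n⇒m≤1+n (below A₁j′)
  oneJob′ : OneJobPerCore A₁
  oneJob′ {j₁} {j₂} e₁ e₂ with j₁ ≟ᶠ j | j₂ ≟ᶠ j
  ... | yes j₁≡j | yes j₂≡j = trans j₁≡j (sym j₂≡j)
  ... | yes _    | no _     = ⊥-elim (i-fresh e₂ (just-injective (sym e₁)))
  ... | no _     | yes _    = ⊥-elim (i-fresh e₁ (just-injective (sym e₂)))
  ... | no _     | no _     = single e₁ e₂

record IsInitialAssignment {n c} (a : Fin n → ℚ) (A₀ : PAssign n c) : Set where
  field
    small-free   : ∀ j → ¬ ½ < a j → A₀ j ≡ nothing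
    large-placed : ∀ j → ½ < a j → ∃[ i ] A₀ j ≡ just i
    oneJob       : OneJobPerCore A₀

length-filter-tabulate : ∀ {n m} {P : Fin m → Set} (P? : ∀ x → Dec (P x)) (f : Fin n → Fin m) →
  length (filter P? (tabulate f)) ≡ count (λ j → does (P? (f j)))
length-filter-tabulate {zero}  P? f = refl
length-filter-tabulate {suc n} P? f with does (P? (f Fin.zero))
... | true  = cong suc (length-filter-tabulate P? (f ∘ Fin.suc))
... | false = length-filter-tabulate P? (f ∘ Fin.suc)

initialAssign-succeeds : ∀ {n c} (a : Fin n → ℚ) → count (λ j → does (½ <? a j)) ℕ.≤ c →
  ∃[ A₀ ] initialAssign a ≡ just A₀ × IsInitialAssignment {c = c} a A₀
initialAssign-succeeds {n} a fits =
  let A₀ , run , P = placeLarge-succeeds 0 (largeJobs a) (λ _ → nothing) fits′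
                       (Unique.filter⁺ large? (Unique.allFin⁺ n)) (λ _ _ → refl) (λ ()) (λ ())
      open Placement P
  in A₀ , run , record
       { small-free   = λ j small → unchanged j (λ j∈ → small (proj₂ (∈-filter⁻ large? {xs = allFin n} j∈)))
       ; large-placed = λ j large → placed j (∈-filter⁺ large? (∈-allFin j) large)
       ; oneJob       = oneJob }
  where
  large? = λ j → ½ <? a j
  fits′ = subst (ℕ._≤ _) (sym (length-filter-tabulate large? (λ j → j))) fits

lsum : ∀ {A : Set} → List A → (A → ℚ) → ℚ
lsum xs f = foldr (λ x acc → f x + acc) 0ℚ xs

lsum-↭ : ∀ {A : Set} {xs ys : List A} (f : A → ℚ) → xs ↭ ys → lsum xs f ≡ lsum ys f
lsum-↭ f ↭.refl          = refl
lsum-↭ f (↭.prep x xs↭ys) = cong (f x +_) (lsum-↭ f xs↭ys)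
lsum-↭ f (↭.swap x y xs↭ys) =
  trans (sym (+-assoc (f x) (f y) _)) (trans (cong₂ _+_ (+-comm (f x) (f y)) (lsum-↭ f xs↭ys)) (+-assoc (f y) (f x) _))
lsum-↭ f (↭.trans xs↭ys ys↭zs) = trans (lsum-↭ f xs↭ys) (lsum-↭ f ys↭zs)

lsum-tabulate : ∀ {n m} (g : Fin n → Fin m) (f : Fin m → ℚ) → lsum (tabulate g) f ≡ sumᶠ (f ∘ g)
lsum-tabulate {zero}  g f = refl
lsum-tabulate {suc n} g f = cong (f (g Fin.zero) +_) (lsum-tabulate (g ∘ Fin.suc) f)

index-of-middle : ∀ {A : Set} {x : A} (D R : List A) → Unique (D ++ x ∷ R) → (x∈ : x ∈ D ++ x ∷ R) →
  Fin.toℕ (index x∈) ≡ length D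
index-of-middle []      R _            (here _)   = refl
index-of-middle []      R (x∉R ∷ _)    (there x∈) = ⊥-elim (All.lookup x∉R x∈ refl)
index-of-middle (d ∷ D) R (d∉ ∷ _)     (here x≡d) = ⊥-elim (All.lookup d∉ (∈-++⁺ʳ D (here (sym x≡d))) refl)
index-of-middle (d ∷ D) R (_ ∷ unique) (there x∈) = cong suc (index-of-middle D R unique x∈)

sumRange : (ℕ → ℚ) → ℕ → ℕ → ℚ
sumRange G d zero    = 0ℚ
sumRange G d (suc e) = G d + sumRange G (suc d) e

<ᵇ-true : ∀ {m n} → m ℕ.< n → (m ℕ.<ᵇ n) ≡ true
<ᵇ-true {m} {n} m<n with m ℕ.<ᵇ n | ℕₚ.<⇒<ᵇ m<n
... | true | _ = refl

<ᵇ-false : ∀ {m n} → ¬ m ℕ.< n → (m ℕ.<ᵇ n) ≡ false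
<ᵇ-false {m} {n} m≮n with m ℕ.<ᵇ n | ℕₚ.<ᵇ⇒< m n
... | true  | <ᵇ⇒< = ⊥-elim (m≮n (<ᵇ⇒< _))
... | false | _    = refl

sumRange-<ᵇ : ∀ k d e → k ℕ.≤ d ℕ.+ e → sumRange (λ q → ind (q ℕ.<ᵇ k) 1ℚ) d e ≡ toℚ (k ℕ.∸ d)
sumRange-<ᵇ k d zero k≤d rewrite ℕₚ.+-identityʳ d | ℕₚ.m≤n⇒m∸n≡0 k≤d = refl
sumRange-<ᵇ k d (suc e) k≤ with d ℕ.<? k
... | yes d<k rewrite <ᵇ-true d<k =
  trans (cong (1ℚ +_) (sumRange-<ᵇ k (suc d) e (subst (k ℕ.≤_) (ℕₚ.+-suc d e) k≤)))
        (cong toℚ (sym (ℕₚ.+-∸-assoc 1 d<k)))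
... | no d≮k rewrite <ᵇ-false d≮k =
  trans (+-identityˡ _)
    (trans (sumRange-<ᵇ k (suc d) e (subst (k ℕ.≤_) (ℕₚ.+-suc d e) k≤))
      (cong toℚ (trans (ℕₚ.m≤n⇒m∸n≡0 (ℕₚ.m≤n⇒m≤1+n (ℕₚ.≮⇒≥ d≮k)))
                       (sym (ℕₚ.m≤n⇒m∸n≡0 (ℕₚ.≮⇒≥ d≮k))))))

module Positions {c : ℕ} (τ : List (Fin c)) (τ↭ : τ ↭ allFin c) where

  unique : Unique τ
  unique = ↭ₛ.Unique-resp-↭ (setoid (Fin c)) (↭.↭⇒↭ₛ (↭-sym τ↭)) (Unique.allFin⁺ c)

  ∈τ : ∀ i → i ∈ τ
  ∈τ i = ∈-resp-↭ (↭-sym τ↭) (∈-allFin i)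

  pos : Fin c → ℕ
  pos i = Fin.toℕ (index (∈τ i))

  pos-injective : ∀ {l i} → pos l ≡ pos i → l ≡ i
  pos-injective {l} {i} eq =
    trans (lookup-index (∈τ l)) (trans (cong (lookup τ) (toℕ-injective eq)) (sym (lookup-index (∈τ i))))

  length-τ : length τ ≡ c
  length-τ = trans (↭-length τ↭) (List.length-tabulate (λ i → i))

  pos<c : ∀ i → pos i ℕ.< c
  pos<c i = subst (pos i ℕ.<_) length-τ (toℕ<n (index (∈τ i)))

  pos-middle : ∀ D i R → τ ≡ D ++ i ∷ R → pos i ≡ length D
  pos-middle D i R refl = index-of-middle D R unique (∈τ i)

  lsum-τ : ∀ f → lsum τ f ≡ sumᶠ f
  lsum-τ f = trans (lsum-↭ f τ↭) (lsum-tabulate (λ i → i) f)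

  lsum-suffix : ∀ (G : ℕ → ℚ) D E → τ ≡ D ++ E → lsum E (G ∘ pos) ≡ sumRange G (length D) (length E)
  lsum-suffix G D []      _  = refl
  lsum-suffix G D (i ∷ E) τ≡ =
    cong₂ _+_ (cong G (pos-middle D i E τ≡))
      (trans (lsum-suffix G (D ++ i ∷ []) E (trans τ≡ (sym (List.++-assoc D (i ∷ []) E))))
             (cong (λ d → sumRange G d (length E)) (trans (List.length-++ D) (ℕₚ.+-comm (length D) 1))))

  count-before : ∀ k → k ℕ.≤ c → sumᶠ (λ l → ind (pos l ℕ.<ᵇ k) 1ℚ) ≡ toℚ k
  count-before k k≤c =
    trans (sym (lsum-τ _))
      (trans (lsum-suffix (λ q → ind (q ℕ.<ᵇ k) 1ℚ) [] τ refl)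
        (trans (cong (sumRange _ 0) length-τ) (sumRange-<ᵇ k 0 c k≤c)))

  private
    allPairs-index : ∀ {R : Fin c → Fin c → Set} {xs} → AllPairs R xs →
      ∀ {x y} (x∈ : x ∈ xs) (y∈ : y ∈ xs) → Fin.toℕ (index x∈) ℕ.< Fin.toℕ (index y∈) → R x y
    allPairs-index (Rx ∷ _)   (here refl) (there y∈) _         = All.lookup Rx y∈
    allPairs-index (_ ∷ Rxs)  (there x∈)  (there y∈) (s≤s lt) = allPairs-index Rxs x∈ y∈ lt

  sorted : ∀ {R : Fin c → Fin c → Set} → (∀ {x y z} → R x y → R y z → R x z) → Linked R τ →
    ∀ {l i} → pos l ℕ.< pos i → R l i
  sorted trans-R linked = allPairs-index (Linked⇒AllPairs trans-R linked) (∈τ _) (∈τ _)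

countAtLeast : ∀ {c} → (Fin c → ℚ) → ℚ → ℕ
countAtLeast p t = count (λ l → leqb t (p l))

zeroAt : ∀ {c} → (Fin c → ℚ) → Fin c → Fin c → ℚ
zeroAt p k l = if ⌊ l ≟ᶠ k ⌋ then 0ℚ else p l

sumᶠ-zeroAt : ∀ {c} (p : Fin c → ℚ) k → sumᶠ p ≡ p k + sumᶠ (zeroAt p k)
sumᶠ-zeroAt p k =
  trans (sumᶠ-cong split) (trans (sumᶠ-distrib-+ _ (zeroAt p k)) (cong (_+ sumᶠ (zeroAt p k)) (sumᶠ-δ′ k p)))
  where
  split : ∀ l → p l ≡ ind ⌊ l ≟ᶠ k ⌋ (p l) + zeroAt p k l
  split l with l ≟ᶠ k
  ... | yes _ = sym (+-identityʳ _)
  ... | no _  = sym (+-identityˡ _)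

zeroAt-nonneg : ∀ {c} (p : Fin c → ℚ) k → (∀ i → 0ℚ ≤ p i) → ∀ i → 0ℚ ≤ zeroAt p k i
zeroAt-nonneg p k p≥0 l with l ≟ᶠ k
... | yes _ = ≤-refl
... | no _  = p≥0 l

zeroAt-other : ∀ {c} (p : Fin c → ℚ) {k l} → l ≢ k → zeroAt p k l ≡ p l
zeroAt-other p {k} {l} l≢k with l ≟ᶠ k
... | yes l≡k = ⊥-elim (l≢k l≡k)
... | no _    = refl

-- Match the first positive demand with a part that covers it and drop that part:
-- every later demand loses at most one covering part.
lsum-≤-sumᶠ-by-rank : ∀ {c} (m : Fin c → ℚ) (E : List (Fin c)) (p : Fin c → ℚ) → (∀ i → 0ℚ ≤ p i) →
  (∀ E₁ i E₂ → E ≡ E₁ ++ i ∷ E₂ → 0ℚ < m i → suc (length E₁) ℕ.≤ countAtLeast p (m i)) →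
  lsum E m ≤ sumᶠ p
lsum-≤-sumᶠ-by-rank m []      p p≥0 rank = sumᶠ-nonneg p≥0
lsum-≤-sumᶠ-by-rank m (i ∷ E) p p≥0 rank with 0ℚ <? m i
... | no m≯0 =
  subst (m i + lsum E m ≤_) (+-identityˡ (sumᶠ p))
    (+-mono-≤ (≮⇒≥ m≯0) (lsum-≤-sumᶠ-by-rank m E p p≥0 (λ E₁ j E₂ E≡ m>0 →
      ℕₚ.≤-pred (ℕₚ.m≤n⇒m≤1+n (rank (i ∷ E₁) j E₂ (cong (i ∷_) E≡) m>0)))))
... | yes m>0 =
  let k , mi≤pk = count>0⇒∃ _ (rank [] i E refl m>0)
      rest = lsum-≤-sumᶠ-by-rank m E (zeroAt p k) (zeroAt-nonneg p k p≥0) λ E₁ j E₂ E≡ mj>0 →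
               ℕₚ.≤-pred (ℕₚ.≤-trans (rank (i ∷ E₁) j E₂ (cong (i ∷_) E≡) mj>0)
                 (count-≤-suc-of-agreeing _ _ k (λ l l≢k → cong (leqb (m j)) (zeroAt-other p l≢k))))
  in subst (m i + lsum E m ≤_) (sym (sumᶠ-zeroAt p k)) (+-mono-≤ (leqb⇒≤ mi≤pk) rest)

≤-convex : ∀ {α P K G L} → 0ℚ ≤ α → α ≤ 1ℚ → P ≤ K → P + G ≤ K + L → P + α * G ≤ K + α * L
≤-convex {α} {P} {K} {G} {L} α≥0 α≤1 P≤K P+G≤K+L = begin
  P + α * G                     ≡⟨ solve 3 (λ α P G → P :+ α :* G := (con 1ℚ :- α) :* P :+ α :* (P :+ G)) refl α P G ⟩
  (1ℚ - α) * P + α * (P + G)    ≤⟨ +-mono-≤ (*-monoˡ-≤-nonNeg (1ℚ - α) {{nonNegative 1-α≥0}} P≤K)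
                                            (*-monoˡ-≤-nonNeg α {{nonNegative α≥0}} P+G≤K+L) ⟩
  (1ℚ - α) * K + α * (K + L)    ≡⟨ solve 3 (λ α K L → (con 1ℚ :- α) :* K :+ α :* (K :+ L) := K :+ α :* L) refl α K L ⟩
  K + α * L                     ∎
  where
  open ≤-Reasoning
  1-α≥0 : 0ℚ ≤ 1ℚ - α
  1-α≥0 = subst (_≤ 1ℚ - α) (+-inverseʳ α) (+-monoˡ-≤ (- α) α≤1)

+-exchange-≤ : ∀ {P G K L H C} → K + H ≡ G + C → P + H ≤ L + C → P + G ≤ K + L
+-exchange-≤ {P} {G} {K} {L} {H} {C} K+H≡G+C P+H≤L+C = begin
  P + G                ≡⟨ solve 3 (λ P G H → P :+ G := (P :+ H) :+ (G :- H)) refl P G H ⟩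
  (P + H) + (G - H)    ≤⟨ +-monoˡ-≤ (G - H) P+H≤L+C ⟩
  (L + C) + (G - H)    ≡⟨ solve 4 (λ L C G H → (L :+ C) :+ (G :- H) := L :+ (G :+ C) :- H) refl L C G H ⟩
  L + (G + C) - H      ≡⟨ cong (λ z → L + z - H) (sym K+H≡G+C) ⟩
  L + (K + H) - H      ≡⟨ solve 3 (λ L K H → L :+ (K :+ H) :- H := K :+ L) refl L K H ⟩
  K + L                ∎
  where open ≤-Reasoning

1-antitone : ∀ {u v} → 1ℚ - u ≤ 1ℚ - v → v ≤ u
1-antitone {u} {v} h = subst₂ _≤_ (cancelˡ u v) (cancelʳ u v) (+-monoˡ-≤ (u + v - 1ℚ) h)
  where
  cancelˡ : ∀ u v → (1ℚ - u) + (u + v - 1ℚ) ≡ v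
  cancelʳ : ∀ u v → (1ℚ - v) + (u + v - 1ℚ) ≡ u
  cancelˡ = solve 2 (λ u v → (con 1ℚ :- u) :+ (u :+ v :- con 1ℚ) := v) refl
  cancelʳ = solve 2 (λ u v → (con 1ℚ :- v) :+ (u :+ v :- con 1ℚ) := u) refl

≤-+-nonnegˡ : ∀ {p q r} → 0ℚ ≤ r → p ≤ q → p ≤ r + q
≤-+-nonnegˡ {p} {q} {r} r≥0 p≤q = ≤-trans p≤q (subst (_≤ r + q) (+-identityˡ q) (+-monoˡ-≤ q r≥0))

≤-+-nonnegʳ : ∀ {p q r} → 0ℚ ≤ r → p ≤ q → p ≤ q + r
≤-+-nonnegʳ {p} {q} {r} r≥0 p≤q = ≤-trans p≤q (subst (_≤ q + r) (+-identityʳ q) (+-monoʳ-≤ q r≥0))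

module Analysis {n c : ℕ} (a x : Fin n → ℚ) (a>0 : ∀ j → 0ℚ < a j) (x≥0 : ∀ j → 0ℚ ≤ x j)
  (p : Fin c → ℚ) (S : Fin n → Fin c) (p≥0 : ∀ i → 0ℚ ≤ p i) (x≤pS : ∀ j → x j ≤ p (S j))
  (load≤1 : MakespanAtMost a S 1ℚ) where

  a≥0 : ∀ j → 0ℚ ≤ a j
  a≥0 j = <⇒≤ (a>0 j)

  a≤load : ∀ j → a j ≤ load a S (S j)
  a≤load j = subst (_≤ load a S (S j)) (ind-≟-refl (S j) (a j))
               (term≤sumᶠ (λ j′ → ind-nonneg ⌊ S j′ ≟ᶠ S j ⌋ (a≥0 j′)) j)

  a≤1 : ∀ j → a j ≤ 1ℚ
  a≤1 j = ≤-trans (a≤load j) (load≤1 (S j))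

  sumᶠ-load : sumᶠ (load a S) ≡ sumᶠ a
  sumᶠ-load = trans (sumᶠ-comm (λ l j → ind ⌊ S j ≟ᶠ l ⌋ (a j))) (sumᶠ-cong (λ j → sumᶠ-δ (S j) (λ _ → a j)))

  large : Fin n → Bool
  large j = ltb ½ (a j)

  largeOn : Fin c → Fin n → Bool
  largeOn l j = large j ∧ ⌊ S j ≟ᶠ l ⌋

  largeCount : Fin c → ℚ
  largeCount l = sumᶠ (λ j → ind (large j) (ind ⌊ S j ≟ᶠ l ⌋ 1ℚ))

  -- Two large jobs on one core would give it load above 1.
  atMostOneLargeOn : ∀ l → count (largeOn l) ℕ.≤ 1
  atMostOneLargeOn l with count (largeOn l) in #≡
  ... | zero  = z≤n
  ... | suc _ = ℕₚ.≤-pred (toℚ-cancel-< (subst (λ k → toℚ k < toℚ 2) #≡ twoHalves<2))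
    where
    b = largeOn l
    halves = sumᶠ (λ j → ind (b j) ½)
    b⇒large : ∀ {j} → b j ≡ true → ½ < a j
    b⇒large {j} bj with large j in large-j
    ... | true = ltb⇒< large-j
    half≤a : ∀ j → ind (b j) ½ ≤ ind (b j) (a j)
    half≤a j with b j in bj
    ... | true  = <⇒≤ (b⇒large bj)
    ... | false = ≤-refl
    onL≤1 : sumᶠ (λ j → ind (b j) (a j)) ≤ 1ℚ
    onL≤1 = ≤-trans (sumᶠ-mono-≤ λ j → subst (_≤ ind ⌊ S j ≟ᶠ l ⌋ (a j)) (sym (ind-∧ (large j) _ (a j)))
                                         (ind-≤ (large j) (ind-nonneg ⌊ S j ≟ᶠ l ⌋ (a≥0 j))))
                    (load≤1 l)
    halves<1 : halves < 1ℚ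
    halves<1 = let k , bk = count>0⇒∃ b (subst (1 ℕ.≤_) (sym #≡) (s≤s z≤n)) in
      <-≤-trans (sumᶠ-mono-< half≤a k (subst (λ v → ind v ½ < ind v (a k)) (sym bk) (b⇒large bk))) onL≤1
    twoHalves<2 : toℚ (count b) < toℚ 2
    twoHalves<2 = subst (_< toℚ 2)
      (trans (sym (sumᶠ-distrib-+ (λ j → ind (b j) ½) (λ j → ind (b j) ½)))
             (trans (sumᶠ-cong (λ j → sym (ind-distrib-+ (b j) ½ ½))) (sumᶠ-ind-1 b)))
      (+-mono-< halves<1 halves<1)

  largeCount≤1 : ∀ l → largeCount l ≤ 1ℚ
  largeCount≤1 l = subst (_≤ 1ℚ)
    (sym (trans (sumᶠ-cong (λ j → sym (ind-∧ (large j) _ 1ℚ))) (sumᶠ-ind-1 (largeOn l))))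
    (toℚ-mono-≤ {n = 1} (atMostOneLargeOn l))

  sumᶠ-largeCount : sumᶠ largeCount ≡ sumᶠ (λ j → ind (large j) 1ℚ)
  sumᶠ-largeCount =
    trans (sumᶠ-comm (λ l j → ind (large j) (ind ⌊ S j ≟ᶠ l ⌋ 1ℚ)))
          (sumᶠ-cong (λ j → trans (sym (ind-distrib-sumᶠ (large j) (λ l → ind ⌊ S j ≟ᶠ l ⌋ 1ℚ)))
                                  (cong (ind (large j)) (sumᶠ-δ (S j) (λ _ → 1ℚ)))))

  fewLargeJobs : count (λ j → does (½ <? a j)) ℕ.≤ c
  fewLargeJobs = subst (ℕ._≤ c) (count-cong (λ j → ltb-does ½ (a j)))
    (toℚ-cancel-≤ (subst₂ _≤_ (trans sumᶠ-largeCount (sumᶠ-ind-1 large)) (sumᶠ-1 c) (sumᶠ-mono-≤ largeCount≤1)))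

  module Initial (A₀ : PAssign n c) (A₀-init : IsInitialAssignment a A₀) where

    open IsInitialAssignment A₀-init

    assigned⇒large : ∀ {j i} → A₀ j ≡ just i → ½ < a j
    assigned⇒large {j} A₀j with ½ <? a j
    ... | yes large = large
    ... | no small with () ← trans (sym A₀j) (small-free j small)

    unassigned⇒small : ∀ {j} → A₀ j ≡ nothing → ¬ ½ < a j
    unassigned⇒small {j} A₀j large with () ← trans (sym A₀j) (proj₂ (large-placed j large))

    large-assigned : ∀ {j i} → A₀ j ≡ just i → large j ≡ true
    large-assigned A₀j = <⇒ltb (assigned⇒large A₀j)

    large-unassigned : ∀ {j} → A₀ j ≡ nothing → large j ≡ false
    large-unassigned A₀j = ≮⇒ltb (unassigned⇒small A₀j)

    s : Fin c → ℚ
    s = loadP a A₀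

    jobsOn : Fin c → ℚ
    jobsOn l = sumᶠ (λ j → ind (isOn (A₀ j) l) 1ℚ)

    sumᶠ-occupied : ∀ {j l} → A₀ j ≡ just l → (w : Fin n → ℚ) →
                    sumᶠ (λ j′ → ind (isOn (A₀ j′) l) (w j′)) ≡ w j
    sumᶠ-occupied {j} {l} A₀j w =
      trans (sumᶠ-single _ j others) (cong (λ b → ind b (w j)) (≡just⇒isOn A₀j))
      where
      others : ∀ j′ → j′ ≢ j → ind (isOn (A₀ j′) l) (w j′) ≡ 0ℚ
      others j′ j′≢j with isOn (A₀ j′) l in on
      ... | true  = ⊥-elim (j′≢j (oneJob (isOn⇒≡just (A₀ j′) l on) A₀j))
      ... | false = refl

    sumᶠ-empty : ∀ {l} → (∀ j → isOn (A₀ j) l ≡ false) → (w : Fin n → ℚ) →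
                 sumᶠ (λ j → ind (isOn (A₀ j) l) (w j)) ≡ 0ℚ
    sumᶠ-empty {l} empty w = trans (sumᶠ-cong (λ j → cong (λ b → ind b (w j)) (empty j))) (sumᶠ-zero {n})

    occupied-or-empty : ∀ l → (∃[ j ] A₀ j ≡ just l) ⊎ (∀ j → isOn (A₀ j) l ≡ false)
    occupied-or-empty l with find (λ j → isOn (A₀ j) l)
    ... | inj₁ (j , on) = inj₁ (j , isOn⇒≡just (A₀ j) l on)
    ... | inj₂ empty    = inj₂ empty

    s≡a : ∀ {j l} → A₀ j ≡ just l → s l ≡ a j
    s≡a A₀j = sumᶠ-occupied A₀j a

    s≥0 : ∀ l → 0ℚ ≤ s l
    s≥0 l = sumᶠ-nonneg (λ j → ind-nonneg (isOn (A₀ j) l) (a≥0 j))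

    s≤1 : ∀ l → s l ≤ 1ℚ
    s≤1 l with occupied-or-empty l
    ... | inj₁ (j , A₀j) = subst (_≤ 1ℚ) (sym (s≡a A₀j)) (a≤1 j)
    ... | inj₂ empty     = subst (_≤ 1ℚ) (sym (sumᶠ-empty empty a)) (<⇒≤ 0<1)

    s>0⇒jobsOn≡1 : ∀ l → 0ℚ < s l → jobsOn l ≡ 1ℚ
    s>0⇒jobsOn≡1 l s>0 with occupied-or-empty l
    ... | inj₁ (j , A₀j) = sumᶠ-occupied A₀j (λ _ → 1ℚ)
    ... | inj₂ empty     = ⊥-elim (<-irrefl refl (subst (0ℚ <_) (sumᶠ-empty empty a) s>0))

    sumᶠ-jobsOn : sumᶠ jobsOn ≡ sumᶠ (λ j → ind (large j) 1ℚ)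
    sumᶠ-jobsOn = trans (sumᶠ-comm (λ l j → ind (isOn (A₀ j) l) 1ℚ))
                        (sumᶠ-cong (λ j → trans (sumᶠ-isOn (A₀ j) 1ℚ) (assigned≡large j)))
      where
      assigned≡large : ∀ j → ind (is-assigned (A₀ j)) 1ℚ ≡ ind (large j) 1ℚ
      assigned≡large j with A₀ j in A₀j
      ... | nothing = cong (λ b → ind b 1ℚ) (sym (large-unassigned A₀j))
      ... | just _  = cong (λ b → ind b 1ℚ) (sym (large-assigned A₀j))

    module Greedy (τ : List (Fin c)) (τ↭ : τ ↭ allFin c)
      (σ₀ : List (Fin n)) (σ₀↭ : σ₀ ↭ smallJobs a) (σ₀-sorted : Linked (λ j j′ → x j′ ≤ x j) σ₀) where

      open Positions τ τ↭

      Small : Fin n → Set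
      Small j = A₀ j ≡ nothing

      record Witness (A : PAssign n c) (m : Fin c → ℚ) (i : Fin c) : Set where
        field
          job          : Fin n
          job-on       : A job ≡ just i
          job-small    : Small job
          m≤x-job      : m i ≤ x job
          earlier-full : ∀ l → pos l ℕ.< pos i → 1ℚ < loadP a A l
          earlier-≥m   : ∀ j l → A j ≡ just l → pos l ℕ.< pos i → Small j → m i ≤ x j

      -- D are the closed cores, i ∷ τ′ the current and remaining ones, σ the pending small jobs.
      record Invariant (A : PAssign n c) (m : Fin c → ℚ) (D τ′ : List (Fin c)) (σ : List (Fin n)) : Set where
        field
          split            : τ ≡ D ++ τ′
          keeps-initial    : ∀ j i → A₀ j ≡ just i → A j ≡ just i
          unassigned⇒pending : ∀ j → A j ≡ nothing → j ∈ σ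
          pending⇒unassigned : ∀ j → j ∈ σ → A j ≡ nothing
          pending⊆σ₀       : ∀ j → j ∈ σ → j ∈ σ₀
          pending-unique   : Unique σ
          pending-sorted   : Linked (λ j j′ → x j′ ≤ x j) σ
          load≤3/2         : ∀ i → loadP a A i ≤ 1ℚ + ½
          x≤m              : ∀ j i → A j ≡ just i → Small j → x j ≤ m i
          m≥0              : ∀ i → 0ℚ ≤ m i
          m-untouched      : ∀ i → length D ℕ.< pos i → m i ≡ 0ℚ
          pending≤placed   : ∀ j → j ∈ σ → ∀ j′ i → A j′ ≡ just i → Small j′ → x j ≤ x j′
          closed-full      : ∀ l → pos l ℕ.< length D → 1ℚ < loadP a A l
          witness          : ∀ i → 0ℚ < m i → Witness A m i

      record Outcome (A : PAssign n c) (m : Fin c → ℚ) : Set where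
        field
          keeps-initial : ∀ j i → A₀ j ≡ just i → A j ≡ just i
          assigned      : ∀ j → ∃[ i ] A j ≡ just i
          load≤3/2      : ∀ i → loadP a A i ≤ 1ℚ + ½
          x≤m           : ∀ j i → A j ≡ just i → Small j → x j ≤ m i
          m≥0           : ∀ i → 0ℚ ≤ m i
          witness       : ∀ i → 0ℚ < m i → Witness A m i

      σ₀-small : ∀ {j} → j ∈ σ₀ → ¬ ½ < a j
      σ₀-small j∈ = proj₂ (∈-filter⁻ (λ j → ¬? (½ <? a j)) {xs = allFin n} (∈-resp-↭ σ₀↭ j∈))

      initial : Invariant A₀ (λ _ → 0ℚ) [] τ σ₀
      initial = record
        { split            = refl
        ; keeps-initial    = λ _ _ A₀j → A₀j
        ; unassigned⇒pending = λ j A₀j → ∈-resp-↭ (↭-sym σ₀↭)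
                                 (∈-filter⁺ (λ j → ¬? (½ <? a j)) (∈-allFin j) (unassigned⇒small A₀j))
        ; pending⇒unassigned = λ j j∈ → small-free j (σ₀-small j∈)
        ; pending⊆σ₀       = λ _ j∈ → j∈
        ; pending-unique   = ↭ₛ.Unique-resp-↭ (setoid (Fin n)) (↭.↭⇒↭ₛ (↭-sym σ₀↭))
                               (Unique.filter⁺ (λ j → ¬? (½ <? a j)) (Unique.allFin⁺ n))
        ; pending-sorted   = σ₀-sorted
        ; load≤3/2         = λ i → ≤-+-nonnegʳ (<⇒≤ (positive⁻¹ ½)) (s≤1 i)
        ; x≤m              = λ _ _ A₀j small → case trans (sym A₀j) small of λ ()
        ; m≥0              = λ _ → ≤-refl
        ; m-untouched      = λ _ _ → refl
        ; pending≤placed   = λ _ _ _ _ A₀j small → case trans (sym A₀j) small of λ ()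
        ; closed-full      = λ _ ()
        ; witness          = λ _ 0<0 → ⊥-elim (<-irrefl refl 0<0) }

      close : ∀ {A m D i τ′ σ} → Invariant A m D (i ∷ τ′) σ → 1ℚ < loadP a A i → Invariant A m (D ++ i ∷ []) τ′ σ
      close {A} {m} {D} {i} {τ′} I full = record
        { split       = trans split (sym (List.++-assoc D (i ∷ []) τ′))
        ; keeps-initial = keeps-initial ; unassigned⇒pending = unassigned⇒pending
        ; pending⇒unassigned = pending⇒unassigned ; pending⊆σ₀ = pending⊆σ₀ ; pending-unique = pending-unique
        ; pending-sorted = pending-sorted ; load≤3/2 = load≤3/2 ; x≤m = x≤m ; m≥0 = m≥0
        ; pending≤placed = pending≤placed ; witness = witness
        ; m-untouched = λ l D′<l → m-untouched l
            (ℕₚ.<-trans (ℕₚ.m<m+n (length D) (s≤s z≤n)) (subst (ℕ._< pos l) (List.length-++ D) D′<l))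
        ; closed-full = closed-full′ }
        where
        open Invariant I
        closed-full′ : ∀ l → pos l ℕ.< length (D ++ i ∷ []) → 1ℚ < loadP a A l
        closed-full′ l l<D′ with pos l ℕ.<? length D
        ... | yes l<D = closed-full l l<D
        ... | no l≮D = subst (λ z → 1ℚ < loadP a A z) (pos-injective (trans (pos-middle D i τ′ split) (sym pos≡))) full
          where
          pos≡ : pos l ≡ length D
          pos≡ = ℕₚ.≤-antisym
            (ℕₚ.≤-pred (subst (pos l ℕ.<_) (trans (List.length-++ D) (ℕₚ.+-comm (length D) 1)) l<D′))
            (ℕₚ.≮⇒≥ l≮D)

      module Assign {A m D i τ′ j σ} (I : Invariant A m D (i ∷ τ′) (j ∷ σ)) (¬full : ¬ 1ℚ < loadP a A i) where

        open Invariant I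

        A′ : PAssign n c
        A′ = assignTo A j i

        m′ : Fin c → ℚ
        m′ = updateAt m i (_⊔ x j)

        Aj≡nothing : A j ≡ nothing
        Aj≡nothing = pending⇒unassigned j (here refl)

        j-small : ¬ ½ < a j
        j-small = σ₀-small (pending⊆σ₀ j (here refl))

        pos-i : pos i ≡ length D
        pos-i = pos-middle D i τ′ split

        assigned≢j : ∀ {j′ l} → A j′ ≡ just l → j′ ≢ j
        assigned≢j Aj′ refl = case trans (sym Aj′) Aj≡nothing of λ ()

        A′-other : ∀ {j′ l} → A′ j′ ≡ just l → j′ ≢ j → A j′ ≡ just l
        A′-other {j′} A′j′ j′≢j = trans (sym (assignTo-other A i j′≢j)) A′j′

        A′-j : ∀ {l} → A′ j ≡ just l → l ≡ i
        A′-j A′j = just-injective (trans (sym A′j) (assignTo-self A j i))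

        m′i≡ : m′ i ≡ m i ⊔ x j
        m′i≡ = updateAt-updates i m

        m′i≤ : ∀ {y} → m i ≤ y → x j ≤ y → m′ i ≤ y
        m′i≤ m≤y x≤y = subst (_≤ _) (sym m′i≡) (⊔-lub m≤y x≤y)

        m′-other : ∀ {l} → l ≢ i → m′ l ≡ m l
        m′-other {l} l≢i = updateAt-minimal l i m l≢i

        m≤m′ : ∀ l → m l ≤ m′ l
        m≤m′ l with l ≟ᶠ i
        ... | yes refl = subst (m i ≤_) (sym m′i≡) (p≤p⊔q (m i) (x j))
        ... | no l≢i   = ≤-reflexive (sym (m′-other l≢i))

        load-other : ∀ {l} → l ≢ i → loadP a A′ l ≡ loadP a A l
        load-other {l} l≢i = trans (loadP-assignTo a A i l Aj≡nothing)
                                   (trans (cong (loadP a A l +_) (ind-≟-≢ (a j) (l≢i ∘ sym))) (+-identityʳ _))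

        load-i : loadP a A′ i ≡ loadP a A i + a j
        load-i = trans (loadP-assignTo a A i i Aj≡nothing) (cong (loadP a A i +_) (ind-≟-refl i (a j)))

        x-j≤ : ∀ {j′ l} → A j′ ≡ just l → Small j′ → x j ≤ x j′
        x-j≤ = pending≤placed j (here refl) _ _

        before⇒≢i : ∀ {l l′} → pos l ℕ.≤ pos i → pos l′ ℕ.< pos l → l′ ≢ i
        before⇒≢i l≤i l′<l refl = ℕₚ.<-irrefl refl (ℕₚ.<-≤-trans l′<l l≤i)

        extend : ∀ {l} → Witness A m l → pos l ℕ.≤ pos i → (∀ {y} → m l ≤ y → x j ≤ y → m′ l ≤ y) →
                 Witness A′ m′ l
        extend {l} W l≤i bound = record
          { job          = job
          ; job-on       = trans (assignTo-other A i (assigned≢j job-on)) job-on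
          ; job-small    = job-small
          ; m≤x-job      = bound m≤x-job (x-j≤ job-on job-small)
          ; earlier-full = λ l′ l′<l → subst (1ℚ <_) (sym (load-other (before⇒≢i l≤i l′<l))) (earlier-full l′ l′<l)
          ; earlier-≥m   = earlier-≥m′ }
          where
          open Witness W
          earlier-≥m′ : ∀ j′ l′ → A′ j′ ≡ just l′ → pos l′ ℕ.< pos l → Small j′ → m′ l ≤ x j′
          earlier-≥m′ j′ l′ A′j′ l′<l small = case j′ ≟ᶠ j of λ where
            (yes refl) → ⊥-elim (before⇒≢i l≤i l′<l (A′-j A′j′))
            (no j′≢j)  → let Aj′ = A′-other A′j′ j′≢j in bound (earlier-≥m j′ l′ Aj′ l′<l small) (x-j≤ Aj′ small)

        fresh : m i ≤ 0ℚ → Witness A′ m′ i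
        fresh m≤0 = record
          { job          = j
          ; job-on       = assignTo-self A j i
          ; job-small    = small-free j j-small
          ; m≤x-job      = m′i≤ (≤-trans m≤0 (x≥0 j)) ≤-refl
          ; earlier-full = λ l l<i → subst (1ℚ <_) (sym (load-other (before⇒≢i ℕₚ.≤-refl l<i)))
                                       (closed-full l (subst (pos l ℕ.<_) pos-i l<i))
          ; earlier-≥m   = earlier-≥m′ }
          where
          earlier-≥m′ : ∀ j′ l → A′ j′ ≡ just l → pos l ℕ.< pos i → Small j′ → m′ i ≤ x j′
          earlier-≥m′ j′ l A′j′ l<i small = case j′ ≟ᶠ j of λ where
            (yes refl) → ⊥-elim (ℕₚ.<-irrefl (cong pos (A′-j A′j′)) l<i)
            (no j′≢j)  → m′i≤ (≤-trans m≤0 (x≥0 j′)) (x-j≤ (A′-other A′j′ j′≢j) small)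

        witness′ : ∀ l → 0ℚ < m′ l → Witness A′ m′ l
        witness′ l m′>0 with l ≟ᶠ i
        ... | yes refl with 0ℚ <? m i
        ...   | yes m>0 = extend (witness i m>0) ℕₚ.≤-refl m′i≤
        ...   | no m≯0  = fresh (≮⇒≥ m≯0)
        witness′ l m′>0 | no l≢i =
          extend (witness l m>0) l≤i (λ m≤y _ → subst (_≤ _) (sym (m′-other l≢i)) m≤y)
          where
          m>0 : 0ℚ < m l
          m>0 = subst (0ℚ <_) (m′-other l≢i) m′>0
          l≤i : pos l ℕ.≤ pos i
          l≤i = subst (pos l ℕ.≤_) (sym pos-i)
                  (ℕₚ.≮⇒≥ λ D<l → <-irrefl (sym (m-untouched l D<l)) m>0)

        step : Invariant A′ m′ D (i ∷ τ′) σ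
        step = record
          { split              = split
          ; keeps-initial      = λ j′ i′ A₀j′ →
              trans (assignTo-other A i (λ { refl → case trans (sym A₀j′) (small-free j j-small) of λ () }))
                    (keeps-initial j′ i′ A₀j′)
          ; unassigned⇒pending = unassigned⇒pending′
          ; pending⇒unassigned = λ j′ j′∈ →
              trans (assignTo-other A i (λ { refl → All.lookup (head-unique pending-unique) j′∈ refl }))
                    (pending⇒unassigned j′ (there j′∈))
          ; pending⊆σ₀         = λ j′ j′∈ → pending⊆σ₀ j′ (there j′∈)
          ; pending-unique     = tail-unique pending-unique
          ; pending-sorted     = Linked.tail pending-sorted
          ; load≤3/2           = load≤3/2′
          ; x≤m                = x≤m′
          ; m≥0                = λ l → ≤-trans (m≥0 l) (m≤m′ l)
          ; m-untouched        = λ l D<l → trans (m′-other (λ { refl → ℕₚ.<-irrefl (sym pos-i) D<l })) (m-untouched l D<l)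
          ; pending≤placed     = pending≤placed′
          ; closed-full        = λ l l<D →
              subst (1ℚ <_) (sym (load-other (before⇒≢i ℕₚ.≤-refl (subst (pos l ℕ.<_) (sym pos-i) l<D))))
                    (closed-full l l<D)
          ; witness            = witness′ }
          where
          head-unique : ∀ {u us} → Unique {A = Fin n} (u ∷ us) → All (u ≢_) us
          head-unique (u∉ ∷ _) = u∉
          tail-unique : ∀ {u us} → Unique {A = Fin n} (u ∷ us) → Unique us
          tail-unique (_ ∷ unique) = unique
          unassigned⇒pending′ : ∀ j′ → A′ j′ ≡ nothing → j′ ∈ σ
          unassigned⇒pending′ j′ A′j′ = case j′ ≟ᶠ j of λ where
            (yes refl) → case trans (sym (assignTo-self A j i)) A′j′ of λ ()
            (no j′≢j)  → case unassigned⇒pending j′ (trans (sym (assignTo-other A i j′≢j)) A′j′) of λ where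
              (here j′≡j)  → ⊥-elim (j′≢j j′≡j)
              (there j′∈σ) → j′∈σ
          load≤3/2′ : ∀ l → loadP a A′ l ≤ 1ℚ + ½
          load≤3/2′ l with l ≟ᶠ i
          ... | yes refl = subst (_≤ 1ℚ + ½) (sym load-i) (+-mono-≤ (≮⇒≥ ¬full) (≮⇒≥ j-small))
          ... | no l≢i   = subst (_≤ 1ℚ + ½) (sym (load-other l≢i)) (load≤3/2 l)
          x≤m′ : ∀ j′ l → A′ j′ ≡ just l → Small j′ → x j′ ≤ m′ l
          x≤m′ j′ l A′j′ small = case j′ ≟ᶠ j of λ where
            (yes refl) → subst (λ z → x j ≤ m′ z) (sym (A′-j A′j′)) (subst (x j ≤_) (sym m′i≡) (p≤q⊔p (m i) (x j)))
            (no j′≢j)  → ≤-trans (x≤m j′ l (A′-other A′j′ j′≢j) small) (m≤m′ l)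
          pending≤placed′ : ∀ j″ → j″ ∈ σ → ∀ j′ l → A′ j′ ≡ just l → Small j′ → x j″ ≤ x j′
          pending≤placed′ j″ j″∈ j′ l A′j′ small = case j′ ≟ᶠ j of λ where
            (yes refl) → All.lookup (Linked⇒All (λ x≤y y≤z → ≤-trans y≤z x≤y) ≤-refl pending-sorted) (there j″∈)
            (no j′≢j)  → pending≤placed j″ (there j″∈) j′ l (A′-other A′j′ j′≢j) small

      -- All cores closed would mean total load above c, but the jobs fit in c cores of capacity 1.
      cores-suffice : ∀ {A m D j σ} → ¬ Invariant A m D [] (j ∷ σ)
      cores-suffice {A} {m} {D} {j} I = <⇒≱ c<total (begin
        sumᶠ (loadP a A)        ≤⟨ sumᶠ-loadP a A a≥0 ⟩
        sumᶠ a                  ≡⟨ sym sumᶠ-load ⟩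
        sumᶠ (load a S)         ≤⟨ sumᶠ-mono-≤ load≤1 ⟩
        sumᶠ {c} (λ _ → 1ℚ)     ∎)
        where
        open ≤-Reasoning
        open Invariant I
        all-closed : ∀ l → 1ℚ < loadP a A l
        all-closed l = closed-full l (subst (pos l ℕ.<_)
          (trans (sym length-τ) (cong length (trans split (List.++-identityʳ D)))) (pos<c l))
        c<total : sumᶠ {c} (λ _ → 1ℚ) < sumᶠ (loadP a A)
        c<total = sumᶠ-mono-< (λ l → <⇒≤ (all-closed l)) (S j) (all-closed (S j))

      outcome : ∀ {A m D τ′} → Invariant A m D τ′ [] → Outcome A m
      outcome {A} I = record
        { keeps-initial = keeps-initial ; assigned = assigned ; load≤3/2 = load≤3/2
        ; x≤m = x≤m ; m≥0 = m≥0 ; witness = witness }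
        where
        open Invariant I
        assigned : ∀ j → ∃[ i ] A j ≡ just i
        assigned j with A j in Aj
        ... | just i  = i , refl
        ... | nothing with () ← unassigned⇒pending j Aj

      Result : PAssign n c → List (Fin c) → List (Fin n) → Set
      Result A τ′ σ = ∃[ A′ ] greedy a A τ′ σ ≡ just A′ × Σ (Fin c → ℚ) (Outcome A′)

      greedy-succeeds : ∀ {A m D τ′ σ} → Invariant A m D τ′ σ → Result A τ′ σ
      greedy-succeeds {A} {m} {σ = []} I = A , refl , m , outcome I
      greedy-succeeds {σ = j ∷ σ} = run
        where
        run : ∀ {A m D τ′} → Invariant A m D τ′ (j ∷ σ) → Result A τ′ (j ∷ σ)
        run {τ′ = []}     I = ⊥-elim (cores-suffice I)
        run {A} {τ′ = i ∷ τ′} I with 1ℚ <? loadP a A i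
        ... | yes full = run (close I full)
        ... | no ¬full = greedy-succeeds (Assign.step I ¬full)

      module Cache (τ-sorted : Linked (λ i i′ → residual a A₀ i′ ≤ residual a A₀ i) τ) where

        s-sorted : ∀ {l i} → pos l ℕ.< pos i → s l ≤ s i
        s-sorted l<i = 1-antitone (sorted (λ r≤ r≤′ → ≤-trans r≤′ r≤) τ-sorted l<i)

        -- If core i (at position k) got small jobs of demand up to t = m i > 0, the optimum has at least
        -- k + 1 cores with cache t. Otherwise, comparing the load of the k full cores before i plus one
        -- more job against what the at most k roomy cores of the optimum can hold gives a contradiction,
        -- once the large jobs are accounted for with weight α = s i.
        module Rank {A m} (O : Outcome A m) (i : Fin c) (m>0 : 0ℚ < m i) where

          open Outcome O
          open Witness (witness i m>0)

          t = m i
          k = pos i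
          α = s i

          before : Fin c → Bool
          before l = pos l ℕ.<ᵇ k

          roomy : Fin c → Bool
          roomy l = leqb t (p l)

          demanding : Fin n → Bool
          demanding j = not (large j) ∧ leqb t (x j)

          largeRoomy : Fin n → Bool
          largeRoomy j = large j ∧ roomy (S j)

          loadBefore largeLoadBefore #largeBefore demandingLoad #roomy largeLoadRoomy #largeRoomy : ℚ
          loadBefore      = sumᶠ (λ j → ind (isIn before (A j)) (a j))
          largeLoadBefore = sumᶠ (λ j → ind (isIn before (A₀ j)) (a j))
          #largeBefore    = sumᶠ (λ j → ind (isIn before (A₀ j)) 1ℚ)
          demandingLoad   = sumᶠ (λ j → ind (demanding j) (a j))
          #roomy          = sumᶠ (λ l → ind (roomy l) 1ℚ)
          largeLoadRoomy  = sumᶠ (λ j → ind (largeRoomy j) (a j))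
          #largeRoomy     = sumᶠ (λ j → ind (largeRoomy j) 1ℚ)

          before⇒< : ∀ {l} → before l ≡ true → pos l ℕ.< k
          before⇒< {l} b = ℕₚ.<ᵇ⇒< (pos l) k (subst T (sym b) tt)

          ¬before⇒≮ : ∀ {l} → before l ≡ false → ¬ pos l ℕ.< k
          ¬before⇒≮ b l<k = subst T b (ℕₚ.<⇒<ᵇ l<k)

          #before≡k : sumᶠ (λ l → ind (before l) 1ℚ) ≡ toℚ k
          #before≡k = count-before k (ℕₚ.<⇒≤ (pos<c i))

          α≤s : ∀ {l} → ¬ pos l ℕ.< k → α ≤ s l
          α≤s {l} l≮k with pos l ℕ.≟ k
          ... | yes l≡k = ≤-reflexive (cong s (sym (pos-injective l≡k)))
          ... | no l≢k  = s-sorted (ℕₚ.≤∧≢⇒< (ℕₚ.≮⇒≥ l≮k) (l≢k ∘ sym))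

          k≤loadBefore : toℚ k ≤ loadBefore
          k≤loadBefore = subst₂ _≤_ #before≡k (sumᶠ-isIn before A a) (sumᶠ-mono-≤ full)
            where
            full : ∀ l → ind (before l) 1ℚ ≤ ind (before l) (loadP a A l)
            full l with before l in b
            ... | true  = <⇒≤ (earlier-full l (before⇒< b))
            ... | false = ≤-refl

          -- The earlier cores carry large jobs and small jobs of demand ≥ t; `job` is one more of the latter.
          loadBefore+job : loadBefore + a job ≤ largeLoadBefore + demandingLoad
          loadBefore+job = subst₂ _≤_
            (trans (sumᶠ-distrib-+ (λ j → ind (isIn before (A j)) (a j)) (λ j → ind ⌊ j ≟ᶠ job ⌋ (a j)))
                   (cong (loadBefore +_) (sumᶠ-δ′ job a)))
            (sumᶠ-distrib-+ (λ j → ind (isIn before (A₀ j)) (a j)) (λ j → ind (demanding j) (a j)))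
            (sumᶠ-mono-≤ pointwise)
            where
            pointwise : ∀ j → ind (isIn before (A j)) (a j) + ind ⌊ j ≟ᶠ job ⌋ (a j)
                            ≤ ind (isIn before (A₀ j)) (a j) + ind (demanding j) (a j)
            pointwise j with A₀ j in A₀j
            ... | just l rewrite keeps-initial j l A₀j | large-assigned A₀j
                               | ⌊≟⌋-≢ {k = j} {job} (λ { refl → case trans (sym A₀j) job-small of λ () }) = ≤-refl
            ... | nothing rewrite large-unassigned A₀j with j ≟ᶠ job
            ...   | yes refl rewrite job-on | <ᵇ-false (ℕₚ.<-irrefl (refl {x = k})) | ≤⇒leqb m≤x-job = ≤-refl
            ...   | no _ with assigned j
            ...     | l , Aj rewrite Aj with before l in b
            ...       | true rewrite ≤⇒leqb (earlier-≥m j l Aj (before⇒< b) A₀j) =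
                        ≤-reflexive (trans (+-identityʳ (a j)) (sym (+-identityˡ (a j))))
            ...       | false = +-monoʳ-≤ 0ℚ (ind-nonneg (leqb t (x j)) (a≥0 j))

          -- In the optimum, demanding small jobs and large jobs on roomy cores all sit on roomy cores.
          optimum-roomy : demandingLoad + largeLoadRoomy ≤ #roomy
          optimum-roomy = ≤-trans (subst (_≤ sumᶠ (λ j → ind (roomy (S j)) (a j)))
                                         (sumᶠ-distrib-+ (λ j → ind (demanding j) (a j)) (λ j → ind (largeRoomy j) (a j)))
                                         (sumᶠ-mono-≤ pointwise))
                                  (subst (_≤ #roomy) (sumᶠ-isIn roomy (λ j → just (S j)) a)
                                         (sumᶠ-mono-≤ (λ l → ind-mono-≤ (roomy l) (load≤1 l))))
            where
            pointwise : ∀ j → ind (demanding j) (a j) + ind (largeRoomy j) (a j) ≤ ind (roomy (S j)) (a j)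
            pointwise j with large j
            ... | true = ≤-reflexive (+-identityˡ _)
            ... | false with leqb t (x j) in t≤x
            ...   | true rewrite ≤⇒leqb {t} {p (S j)} (≤-trans (leqb⇒≤ t≤x) (x≤pS j)) = ≤-reflexive (+-identityʳ _)
            ...   | false = subst (_≤ ind (roomy (S j)) (a j)) (sym (+-identityˡ 0ℚ)) (ind-nonneg (roomy (S j)) (a≥0 j))

          -- A large job before i weighs at most α, one at or after i at least α.
          large-exchange : largeLoadBefore + α * #largeRoomy ≤ largeLoadRoomy + α * #largeBefore
          large-exchange = subst₂ _≤_
            (trans (sumᶠ-distrib-+ (λ j → ind (isIn before (A₀ j)) (a j)) (λ j → α * ind (largeRoomy j) 1ℚ))
                   (cong (largeLoadBefore +_) (sumᶠ-distribˡ-* α (λ j → ind (largeRoomy j) 1ℚ))))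
            (trans (sumᶠ-distrib-+ (λ j → ind (largeRoomy j) (a j)) (λ j → α * ind (isIn before (A₀ j)) 1ℚ))
                   (cong (largeLoadRoomy +_) (sumᶠ-distribˡ-* α (λ j → ind (isIn before (A₀ j)) 1ℚ))))
            (sumᶠ-mono-≤ pointwise)
            where
            pointwise : ∀ j → ind (isIn before (A₀ j)) (a j) + α * ind (largeRoomy j) 1ℚ
                            ≤ ind (largeRoomy j) (a j) + α * ind (isIn before (A₀ j)) 1ℚ
            pointwise j with A₀ j in A₀j
            ... | nothing rewrite large-unassigned A₀j = ≤-refl
            ... | just l rewrite large-assigned A₀j with before l in b | roomy (S j)
            ...   | true  | true  = ≤-refl
            ...   | true  | false = subst₂ _≤_ (sym (trans (cong (a j +_) (*-zeroʳ α)) (+-identityʳ (a j))))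
                                               (sym (trans (+-identityˡ _) (*-identityʳ α)))
                                               (subst (_≤ α) (s≡a A₀j) (s-sorted (before⇒< b)))
            ...   | false | true  = subst₂ _≤_ (sym (trans (+-identityˡ _) (*-identityʳ α)))
                                               (sym (trans (cong (a j +_) (*-zeroʳ α)) (+-identityʳ (a j))))
                                               (subst (α ≤_) (s≡a A₀j) (α≤s (¬before⇒≮ b)))
            ...   | false | false = ≤-refl

          -- When α > 0 every core from i on carries a large job, and the optimum has at most one per core.
          module _ (α>0 : 0ℚ < α) where

            #before+#large : toℚ k + sumᶠ largeCount ≡ #largeBefore + toℚ c
            #before+#large =
              trans (cong (toℚ k +_) (trans sumᶠ-largeCount (sym sumᶠ-jobsOn)))
                (trans (sym (trans (sumᶠ-distrib-+ (λ l → ind (before l) 1ℚ) jobsOn) (cong (_+ sumᶠ jobsOn) #before≡k)))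
                  (trans (sumᶠ-cong pointwise)
                    (trans (sumᶠ-distrib-+ (λ l → ind (before l) (jobsOn l)) (λ _ → 1ℚ))
                      (cong₂ _+_ (sumᶠ-isIn before A₀ (λ _ → 1ℚ)) (sumᶠ-1 c)))))
              where
              pointwise : ∀ l → ind (before l) 1ℚ + jobsOn l ≡ ind (before l) (jobsOn l) + 1ℚ
              pointwise l with before l in b
              ... | true  = +-comm 1ℚ (jobsOn l)
              ... | false = cong (0ℚ +_) (s>0⇒jobsOn≡1 l (<-≤-trans α>0 (α≤s (¬before⇒≮ b))))

            #roomy+#large : #roomy + sumᶠ largeCount ≤ #largeRoomy + toℚ c
            #roomy+#large = subst₂ _≤_ (sumᶠ-distrib-+ (λ l → ind (roomy l) 1ℚ) largeCount)
              (trans (sumᶠ-distrib-+ (λ l → ind (roomy l) (largeCount l)) (λ _ → 1ℚ)) (cong₂ _+_ roomyLarge (sumᶠ-1 c)))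
              (sumᶠ-mono-≤ pointwise)
              where
              pointwise : ∀ l → ind (roomy l) 1ℚ + largeCount l ≤ ind (roomy l) (largeCount l) + 1ℚ
              pointwise l with roomy l
              ... | true  = ≤-reflexive (+-comm 1ℚ (largeCount l))
              ... | false = +-monoʳ-≤ 0ℚ (largeCount≤1 l)
              roomyLarge : sumᶠ (λ l → ind (roomy l) (largeCount l)) ≡ #largeRoomy
              roomyLarge =
                trans (sumᶠ-cong (λ l → cong (ind (roomy l)) (sumᶠ-cong (λ j → ind-comm (large j) ⌊ S j ≟ᶠ l ⌋ 1ℚ))))
                  (trans (sumᶠ-isIn roomy (λ j → just (S j)) (λ j → ind (large j) 1ℚ))
                    (sumᶠ-cong (λ j → trans (ind-comm (roomy (S j)) (large j) 1ℚ) (sym (ind-∧ (large j) (roomy (S j)) 1ℚ)))))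

            #roomy+#largeBefore : #roomy + #largeBefore ≤ toℚ k + #largeRoomy
            #roomy+#largeBefore = +-exchange-≤ {#roomy} {#largeBefore} {toℚ k} {#largeRoomy} #before+#large #roomy+#large

          rank : suc k ℕ.≤ countAtLeast p t
          rank with suc k ℕ.≤? countAtLeast p t
          ... | yes k<#roomy = k<#roomy
          ... | no  k≮#roomy = ⊥-elim (<⇒≱ upper lower)
            where
            #roomy≤k : #roomy ≤ toℚ k
            #roomy≤k = subst (_≤ toℚ k) (sym (sumᶠ-ind-1 roomy)) (toℚ-mono-≤ (ℕₚ.≤-pred (ℕₚ.≰⇒> k≮#roomy)))
            k<loads : toℚ k < largeLoadBefore + demandingLoad
            k<loads = <-≤-trans (subst (_< toℚ k + a job) (+-identityʳ (toℚ k)) (+-monoʳ-< (toℚ k) (a>0 job)))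
                                (≤-trans (+-monoˡ-≤ (a job) k≤loadBefore) loadBefore+job)
            upper : toℚ k + α * #largeRoomy < #roomy + α * #largeBefore
            upper = begin-strict
              toℚ k + α * #largeRoomy                              <⟨ +-monoˡ-< _ k<loads ⟩
              (largeLoadBefore + demandingLoad) + α * #largeRoomy  ≡⟨ xy∙z≈xz∙y largeLoadBefore _ _ ⟩
              (largeLoadBefore + α * #largeRoomy) + demandingLoad  ≤⟨ +-monoˡ-≤ _ large-exchange ⟩
              (largeLoadRoomy + α * #largeBefore) + demandingLoad  ≡⟨ xy∙z≈zx∙y largeLoadRoomy _ _ ⟩
              (demandingLoad + largeLoadRoomy) + α * #largeBefore  ≤⟨ +-monoˡ-≤ _ optimum-roomy ⟩
              #roomy + α * #largeBefore                            ∎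
              where open ≤-Reasoning
            lower : #roomy + α * #largeBefore ≤ toℚ k + α * #largeRoomy
            lower with 0ℚ <? α
            ... | yes α>0 = ≤-convex (s≥0 i) (s≤1 i) #roomy≤k (#roomy+#largeBefore α>0)
            ... | no  α≯0 rewrite ≤-antisym (≮⇒≥ α≯0) (s≥0 i) | *-zeroˡ #largeBefore | *-zeroˡ #largeRoomy =
              +-monoˡ-≤ 0ℚ #roomy≤k

        sumᶠ-m≤sumᶠ-p : ∀ {A m} → Outcome A m → sumᶠ m ≤ sumᶠ p
        sumᶠ-m≤sumᶠ-p {m = m} O = subst (_≤ sumᶠ p) (lsum-τ m)
          (lsum-≤-sumᶠ-by-rank m τ p p≥0 λ D i R τ≡ m>0 →
            subst (λ k → suc k ℕ.≤ countAtLeast p (m i)) (pos-middle D i R τ≡) (Rank.rank O i m>0))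

        largeDemand : Fin c → ℚ
        largeDemand l = sumᶠ (λ j → ind (isOn (A₀ j) l) (x j))

        -- Large jobs sit on distinct cores of the optimum, and x j ≤ p (S j).
        sumᶠ-largeDemand : sumᶠ largeDemand ≤ sumᶠ p
        sumᶠ-largeDemand = begin
          sumᶠ largeDemand                                 ≡⟨ sumᶠ-comm (λ l j → ind (isOn (A₀ j) l) (x j)) ⟩
          sumᶠ (λ j → sumᶠ (λ l → ind (isOn (A₀ j) l) (x j))) ≤⟨ sumᶠ-mono-≤ pointwise ⟩
          sumᶠ (λ j → ind (large j) (p (S j)))              ≡⟨ regroup ⟩
          sumᶠ (λ l → p l * largeCount l)                   ≤⟨ sumᶠ-mono-≤ p·largeCount≤p ⟩
          sumᶠ p                                            ∎
          where
          open ≤-Reasoning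
          p·largeCount≤p : ∀ l → p l * largeCount l ≤ p l
          p·largeCount≤p l = subst (p l * largeCount l ≤_) (*-identityʳ (p l))
                                   (*-monoˡ-≤-nonNeg (p l) {{nonNegative (p≥0 l)}} (largeCount≤1 l))
          pointwise : ∀ j → sumᶠ (λ l → ind (isOn (A₀ j) l) (x j)) ≤ ind (large j) (p (S j))
          pointwise j rewrite sumᶠ-isOn (A₀ j) (x j) with A₀ j in A₀j
          ... | nothing = ind-nonneg (large j) (p≥0 (S j))
          ... | just _ rewrite large-assigned A₀j = x≤pS j
          ind-as-* : ∀ b b′ q → ind b (ind b′ q) ≡ q * ind b′ (ind b 1ℚ)
          ind-as-* true  true  q = sym (*-identityʳ q)
          ind-as-* true  false q = sym (*-zeroʳ q)
          ind-as-* false true  q = sym (*-zeroʳ q)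
          ind-as-* false false q = sym (*-zeroʳ q)
          regroup : sumᶠ (λ j → ind (large j) (p (S j))) ≡ sumᶠ (λ l → p l * largeCount l)
          regroup =
            trans (sumᶠ-cong (λ j → sym (sumᶠ-δ (S j) (λ l → ind (large j) (p l)))))
              (trans (sym (sumᶠ-comm (λ l j → ind ⌊ S j ≟ᶠ l ⌋ (ind (large j) (p l)))))
                (sumᶠ-cong (λ l → trans (sumᶠ-cong (λ j → ind-as-* ⌊ S j ≟ᶠ l ⌋ (large j) (p l)))
                                        (sumᶠ-distribˡ-* (p l) (λ j → ind (large j) (ind ⌊ S j ≟ᶠ l ⌋ 1ℚ))))))

        cacheOf≤ : ∀ {A m} → Outcome A m → ∀ l → cacheOf x A l ≤ largeDemand l + m l
        cacheOf≤ {A} {m} O l = cacheOf-≤ x A l (≤-+-nonnegʳ (m≥0 l) largeDemand≥0) bound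
          where
          open Outcome O
          largeDemand≥0 : 0ℚ ≤ largeDemand l
          largeDemand≥0 = sumᶠ-nonneg (λ j → ind-nonneg (isOn (A₀ j) l) (x≥0 j))
          bound : ∀ j → A j ≡ just l → x j ≤ largeDemand l + m l
          bound j Aj with A₀ j in A₀j
          ... | nothing = ≤-+-nonnegˡ largeDemand≥0 (x≤m j l Aj A₀j)
          ... | just l′ with refl ← just-injective (trans (sym (keeps-initial j l′ A₀j)) Aj) =
            ≤-+-nonnegʳ (m≥0 l) (subst (_≤ largeDemand l) (cong (λ b → ind b (x j)) (≡just⇒isOn A₀j))
                                       (term≤sumᶠ (λ j′ → ind-nonneg (isOn (A₀ j′) l) (x≥0 j′)) j))

        cache≤ : ∀ {A m} → Outcome A m → cacheUsed (cacheOf x A) ≤ sumᶠ p + sumᶠ p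
        cache≤ {A} {m} O = ≤-trans (sumᶠ-mono-≤ (cacheOf≤ O))
          (subst (_≤ sumᶠ p + sumᶠ p) (sym (sumᶠ-distrib-+ largeDemand m)) (+-mono-≤ sumᶠ-largeDemand (sumᶠ-m≤sumᶠ-p O)))

runA32-succeeds : ∀ {n c} (a x : Fin n → ℚ) K τ σ {A₀ A : PAssign n c} → initialAssign a ≡ just A₀ →
  greedy a A₀ τ σ ≡ just A → cacheUsed (cacheOf x A) ≤ K + K → runA32 a x K τ σ ≡ just A
runA32-succeeds a x K τ σ {A = A} init≡ greedy≡ cache≤ rewrite init≡ | greedy≡ with cacheUsed (cacheOf x A) ≤? K + K
... | yes _  = refl
... | no cache≰ = ⊥-elim (cache≰ cache≤)

theorem6 : (n c : ℕ) (a x : Fin n → ℚ) (K : ℚ)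
  → (∀ j → 0ℚ < a j) → (∀ j → 0ℚ ≤ x j)
  → (Σ (Fin c → ℚ) λ p → Σ (Fin n → Fin c) λ S →
       ValidSolution x p S × cacheUsed p ≤ K × MakespanAtMost a S 1ℚ)
  → Σ (PAssign n c) λ A₀ → (initialAssign a ≡ just A₀) ×
    ((τ : List (Fin c)) → τ ↭ allFin c
      → Linked (λ i i′ → residual a A₀ i′ ≤ residual a A₀ i) τ
      → (σ : List (Fin n)) → σ ↭ smallJobs a
      → Linked (λ j j′ → x j′ ≤ x j) σ
      → Σ (PAssign n c) λ A → (runA32 a x K τ σ ≡ just A)
          × (∀ j → Σ (Fin c) λ i → (A j ≡ just i) × (x j ≤ cacheOf x A i))
          × (cacheUsed (cacheOf x A) ≤ K + K)
          × (∀ i → loadP a A i ≤ 1ℚ + ½))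
theorem6 n c a x K a>0 x≥0 (p , S , (p≥0 , x≤pS) , p≤K , load≤1)
  with initialAssign-succeeds a (Analysis.fewLargeJobs a x a>0 x≥0 p S p≥0 x≤pS load≤1)
... | A₀ , init≡ , A₀-init = A₀ , init≡ , λ τ τ↭ τ-sorted σ σ↭ σ-sorted →
  let open Greedy τ τ↭ σ σ↭ σ-sorted
      A , greedy≡ , m , O = greedy-succeeds initial
      open Outcome O
      cache≤2K = ≤-trans (Cache.cache≤ τ-sorted O) (+-mono-≤ p≤K p≤K)
  in A , runA32-succeeds a x K τ σ init≡ greedy≡ cache≤2K
       , (λ j → let i , Aj = assigned j in i , Aj , ≤-cacheOf x A Aj)
       , cache≤2K , load≤3/2
  where
  open Analysis a x a>0 x≥0 p S p≥0 x≤pS load≤1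
  open Initial A₀ A₀-init
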